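{- Let $q$ be a prime power and $r\geq 1$. Let $M$ be a matroid whose simplification is isomorphic to $PG(r-1,q)$. Then $$\frac{|E(M)|}{g^\ast(M)}\geq\frac{q^r-1}{q^{r-1}(q-1)}.$$ Moreover, equality holds if and only if $M$ is loopless and all its parallel classes have the same size.
   Context: For a matroid $M$ of nonzero rank, the cogirth $g^\ast(M)$ is the size of a smallest cocircuit of $M$. -}

module Defs where

open import Level using (0ℓ)
open import Data.Nat using (ℕ; zero; suc; _+_; _≤_; _<_; _∸_)
open import Data.Fin using (Fin; zero; suc)
open import Data.Fin.Subset
  using (Subset; ⊤; ⁅_⁆; _∈_; _∉_; _⊆_; ∁; _∩_; _∪_; ∣_∣)
open import Data.Vec using (lookup)
open import Data.Product using (Σ; ∃; ∃-syntax; _×_; _,_)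
open import Data.Sum using (_⊎_)
open import Relation.Nullary using (¬_)
open import Relation.Binary.PropositionalEquality using (_≡_; _≢_)
open import Algebra.Bundles using (CommutativeRing)

record Matroid (n : ℕ) : Set where
  field
    rk        : Subset n → ℕ
    rk-bound  : ∀ X → rk X ≤ ∣ X ∣
    rk-mono   : ∀ {X Y} → X ⊆ Y → rk X ≤ rk Y
    rk-submod : ∀ X Y → rk (X ∪ Y) + rk (X ∩ Y) ≤ rk X + rk Y

module _ {n : ℕ} (M : Matroid n) where
  open Matroid M

  rank : ℕ
  rank = rk ⊤

  Dependent : Subset n → Set
  Dependent X = rk X < ∣ X ∣

  Circuit : Subset n → Set
  Circuit C = Dependent C × (∀ D → D ⊆ C → Dependent D → D ≡ C)

  dualRk : Subset n → ℕ
  dualRk X = (∣ X ∣ + rk (∁ X)) ∸ rk ⊤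

  DualDependent : Subset n → Set
  DualDependent X = dualRk X < ∣ X ∣

  Cocircuit : Subset n → Set
  Cocircuit C = DualDependent C × (∀ D → D ⊆ C → DualDependent D → D ≡ C)

  IsCogirth : ℕ → Set
  IsCogirth g = (∃[ C ] (Cocircuit C × ∣ C ∣ ≡ g))
              × (∀ C → Cocircuit C → g ≤ ∣ C ∣)

  Loop : Fin n → Set
  Loop e = Circuit ⁅ e ⁆

  Loopless : Set
  Loopless = ∀ e → ¬ Loop e

  Parallel : Fin n → Fin n → Set
  Parallel e f = e ≢ f × Circuit (⁅ e ⁆ ∪ ⁅ f ⁆)

  ParClassSize : Fin n → ℕ → Set
  ParClassSize e k = ∃[ P ] (∣ P ∣ ≡ k × (∀ f → (f ∈ P → (f ≡ e ⊎ Parallel e f))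
                                              × ((f ≡ e ⊎ Parallel e f) → f ∈ P)))

  -- Then si(M) is (up to isomorphism) the restriction M|S.
  SimplificationSet : Subset n → Set
  SimplificationSet S =
      (∀ e → e ∈ S → ¬ Loop e)
    × (∀ e f → e ∈ S → f ∈ S → ¬ Parallel e f)
    × (∀ e → ¬ Loop e → ∃[ f ] (f ∈ S × (f ≡ e ⊎ Parallel e f)))

record Field : Set₁ where
  field
    ring : CommutativeRing 0ℓ 0ℓ
  open CommutativeRing ring
  field
    1≉0 : ¬ (1# ≈ 0#)
    inv : ∀ x → ¬ (x ≈ 0#) → ∃[ y ] (x * y ≈ 1#)

module FieldOps (F : Field) where
  open CommutativeRing (Field.ring F) public
    using (Carrier; _≈_; 0#; 1#) renaming (_+_ to _+F_; _*_ to _*F_)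

  HasOrder : ℕ → Set
  HasOrder q = Σ (Fin q → Carrier) λ enum →
      (∀ x → ∃[ i ] (enum i ≈ x))
    × (∀ i j → enum i ≈ enum j → i ≡ j)

  sumF : ∀ {m} → (Fin m → Carrier) → Carrier
  sumF {zero}  c = 0#
  sumF {suc m} c = c zero +F sumF (λ i → c (suc i))

  IsZeroVec : ∀ {r} → (Fin r → Carrier) → Set
  IsZeroVec v = ∀ j → v j ≈ 0#

  LinIndep : ∀ {m r} → (Fin m → Fin r → Carrier) → Subset m → Set
  LinIndep p Y = ∀ (c : Fin _ → Carrier) →
      (∀ i → i ∉ Y → c i ≈ 0#) →
      IsZeroVec (λ j → sumF (λ i → c i *F p i j)) →
      ∀ i → i ∈ Y → c i ≈ 0#

  VRank : ∀ {m r} → (Fin m → Fin r → Carrier) → Subset m → ℕ → Set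
  VRank p X k = (∃[ Y ] (Y ⊆ X × LinIndep p Y × ∣ Y ∣ ≡ k))
              × (∀ Y → Y ⊆ X → LinIndep p Y → ∣ Y ∣ ≤ k)

  -- p : Fin m → F^r lists exactly one nonzero representative of each
  -- 1-dimensional subspace of F^r, i.e. the points of PG(r-1, F)
  ProjPoints : ∀ {m r} → (Fin m → Fin r → Carrier) → Set
  ProjPoints {m} {r} p =
      (∀ i → ¬ IsZeroVec (p i))
    × (∀ (v : Fin r → Carrier) → ¬ IsZeroVec v →
         ∃[ i ] ∃[ a ] (∀ j → v j ≈ a *F p i j))
    × (∀ i i' → i ≢ i' → ¬ (∃[ a ] (∀ j → p i j ≈ a *F p i' j)))

-- The restriction M|S is isomorphic to PG(r-1, F): PG(r-1,F) is the vector
-- matroid of a family p listing one nonzero vector from each 1-dimensional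
-- subspace of F^r; φ is a bijection from its ground set Fin m onto S
-- preserving rank.
RestrictionIsoPG : ∀ {n} → Matroid n → Subset n → Field → ℕ → Set
RestrictionIsoPG {n} M S F r =
  ∃[ m ] Σ (Fin m → Fin n) λ φ → Σ (Fin m → Fin r → FieldOps.Carrier F) λ p →
      FieldOps.ProjPoints F p
    × (∀ i i' → φ i ≡ φ i' → i ≡ i')
    × (∀ e → (e ∈ S → ∃[ i ] (φ i ≡ e)) × (∃[ i ] (φ i ≡ e) → e ∈ S))
    × (∀ X → X ⊆ S →
         FieldOps.VRank F p (Data.Vec.tabulate (λ i → lookup X (φ i)))
                            (Matroid.rk M X))
  where import Data.Vec

SimpIsoPG : ∀ {n} → Matroid n → Field → ℕ → Set
SimpIsoPG M F r = ∃[ S ] (SimplificationSet M S × RestrictionIsoPG M S F r)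

-- Send each nonloop of M to the point of PG(r-1,q) it is parallel to, and for a nonzero
-- functional a on F^r let C a be the set of elements whose point lies off the hyperplane a ⊥.
-- The complement of C a spans at most a hyperplane, so C a is codependent; conversely the
-- complement of a codependent set spans a proper flat, which lies in some hyperplane, so every
-- codependent set contains some C a. Hence g is the least ∣ C a ∣. Every nonloop lies in C a for
-- exactly q^(r-1)(q-1) of the q^r - 1 nonzero functionals, and summing g ≤ ∣ C a ∣ over them gives
-- the inequality, with equality only if M is loopless and every ∣ C a ∣ equals g. Summing ∣ C a ∣
-- over the functionals that miss a fixed point then writes g q^(r-1)(q-1) as w B + (n - w) X, where
-- w is the size of the parallel class at that point, B = q^(r-1)(q-1), and X < B counts the
-- functionals missing two given points; so w does not depend on the point. Conversely, if every
-- parallel class has k elements then ∣ C a ∣ = k q^(r-1) for every nonzero a, and equality follows.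

module Submission where

open import Defs

open import Algebra.Bundles using (CommutativeRing)
import Algebra.Properties.CommutativeSemigroup as CommSemigroupProperties
import Algebra.Properties.Ring as RingProperties
import Algebra.Properties.Semiring.Sum as SemiringSum
open import Data.Bool using (Bool; true; false; not)
import Data.Bool.Properties as Boolₚ
open import Data.Empty using (⊥-elim)
open import Data.Fin using (Fin; zero; suc; funToFin; finToFun; combine)
import Data.Fin.Properties as Finₚ
open import Data.Fin.Subset using (Subset; _∈_; _∉_; ∣_∣; inside; outside; ⁅_⁆; _∪_; _∩_; _⊆_; ⊤; ∁)
import Data.Fin.Subset.Properties as Subₚ
open import Data.Maybe using (Maybe; just; nothing; is-just)
import Data.Maybe.Properties as Maybeₚ
open import Data.Nat as ℕ using (ℕ; zero; suc; _^_; _∸_; s≤s; z≤n)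
import Data.Nat.Properties as ℕₚ
open import Data.Nat.Tactic.RingSolver using (solve-∀)
open import Data.Product using (∃; ∃₂; ∃-syntax; _×_; _,_; proj₁; proj₂)
open import Data.Sum using (_⊎_; inj₁; inj₂)
open import Data.Vec using (Vec; []; _∷_; here; there; lookup; tabulate)
import Data.Vec.Properties as Vecₚ
open import Function using (_∘_; _⇔_; mk⇔; Equivalence)
open import Level using (Level)
open import Relation.Binary.PropositionalEquality as ≡ using (_≡_; _≢_)
import Relation.Binary.Reasoning.Setoid
open import Relation.Nullary using (¬_; ¬?; Dec; yes; no; does; _×-dec_)
open import Relation.Nullary.Decidable using (dec-true; dec-false; does-⇔; decidable-stable)

module NatSums where

  open import Data.Nat using (_+_; _*_; _≤_; _<_)
  open import Data.Nat.Properties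
  open import Relation.Binary.PropositionalEquality

  open SemiringSum +-*-semiring public using (sum; sum-syntax; ∑-distrib-+; ∑-comm)
  open SemiringSum +-*-semiring using (sum-cong-≗; *-distribˡ-sum; *-distribʳ-sum)

  𝟙 : Bool → ℕ
  𝟙 true  = 1
  𝟙 false = 0

  𝟙≤1 : ∀ b → 𝟙 b ≤ 1
  𝟙≤1 true  = ≤-refl
  𝟙≤1 false = z≤n

  𝟙-+-not : ∀ b → 𝟙 b + 𝟙 (not b) ≡ 1
  𝟙-+-not true  = refl
  𝟙-+-not false = refl

  𝟙-idem : ∀ b → 𝟙 b * 𝟙 b ≡ 𝟙 b
  𝟙-idem true  = refl
  𝟙-idem false = refl

  ∑-cong : ∀ k {f g : Fin k → ℕ} → (∀ i → f i ≡ g i) → sum f ≡ sum g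
  ∑-cong k = sum-cong-≗

  ∑-const : ∀ k c → ∑[ i < k ] c ≡ k * c
  ∑-const zero    c = refl
  ∑-const (suc k) c = cong (c +_) (∑-const k c)

  ∑-zero : ∀ k {f : Fin k → ℕ} → (∀ i → f i ≡ 0) → sum f ≡ 0
  ∑-zero k f≗0 = trans (∑-cong k f≗0) (trans (∑-const k 0) (*-zeroʳ k))

  ∑-mono-≤ : ∀ k {f g : Fin k → ℕ} → (∀ i → f i ≤ g i) → sum f ≤ sum g
  ∑-mono-≤ zero    f≤g = z≤n
  ∑-mono-≤ (suc k) f≤g = +-mono-≤ (f≤g zero) (∑-mono-≤ k (λ i → f≤g (suc i)))

  ∑-single : ∀ k {f : Fin k → ℕ} i₀ → (∀ i → i ≢ i₀ → f i ≡ 0) → sum f ≡ f i₀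
  ∑-single (suc k) {f} zero      f≡0 =
    trans (cong (f zero +_) (∑-zero k (λ i → f≡0 (suc i) λ ()))) (+-identityʳ _)
  ∑-single (suc k) {f} (suc i₀) f≡0 = cong₂ _+_ (f≡0 zero λ ())
    (∑-single k i₀ (λ i i≢i₀ → f≡0 (suc i) (i≢i₀ ∘ Finₚ.suc-injective)))

  ∑-*ˡ : ∀ k c (f : Fin k → ℕ) → ∑[ i < k ] (c * f i) ≡ c * sum f
  ∑-*ˡ k c f = sym (*-distribˡ-sum c f)

  ∑-*ʳ : ∀ k c (f : Fin k → ℕ) → ∑[ i < k ] (f i * c) ≡ sum f * c
  ∑-*ʳ k c f = sym (*-distribʳ-sum c f)

  ∑-≤-tight : ∀ k {f g : Fin k → ℕ} → (∀ i → f i ≤ g i) → sum g ≤ sum f → ∀ i → f i ≡ g i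
  ∑-≤-tight (suc k) f≤g Σg≤Σf zero = ≤-antisym (f≤g zero)
    (+-cancelʳ-≤ _ _ _ (≤-trans Σg≤Σf (+-monoʳ-≤ _ (∑-mono-≤ k (λ i → f≤g (suc i))))))
  ∑-≤-tight (suc k) f≤g Σg≤Σf (suc i) = ∑-≤-tight k (λ j → f≤g (suc j))
    (+-cancelˡ-≤ _ _ _ (≤-trans (+-monoˡ-≤ _ (f≤g zero)) Σg≤Σf)) i

  ∑-𝟙≤ : ∀ k (b : Fin k → Bool) → ∑[ i < k ] 𝟙 (b i) ≤ k
  ∑-𝟙≤ k b = ≤-trans (∑-mono-≤ k (λ i → 𝟙≤1 (b i))) (≤-reflexive (trans (∑-const k 1) (*-identityʳ k)))

  ∑-𝟙-+-not : ∀ k (b : Fin k → Bool) → ∑[ i < k ] 𝟙 (b i) + ∑[ i < k ] 𝟙 (not (b i)) ≡ k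
  ∑-𝟙-+-not k b = begin
    ∑[ i < k ] 𝟙 (b i) + ∑[ i < k ] 𝟙 (not (b i))  ≡⟨ ∑-distrib-+ (λ i → 𝟙 (b i)) _ ⟨
    ∑[ i < k ] (𝟙 (b i) + 𝟙 (not (b i)))          ≡⟨ ∑-cong k (λ i → 𝟙-+-not (b i)) ⟩
    ∑[ i < k ] 1                                  ≡⟨ trans (∑-const k 1) (*-identityʳ k) ⟩
    k                                             ∎
    where open ≡-Reasoning

  module VecSum (q : ℕ) where

    ∑V : ∀ r → (Vec (Fin q) r → ℕ) → ℕ
    ∑V zero    f = f []
    ∑V (suc r) f = ∑[ x < q ] ∑V r (λ v → f (x ∷ v))

    ∑V-cong : ∀ r {f g : Vec (Fin q) r → ℕ} → (∀ v → f v ≡ g v) → ∑V r f ≡ ∑V r g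
    ∑V-cong zero    f≗g = f≗g []
    ∑V-cong (suc r) f≗g = ∑-cong q (λ x → ∑V-cong r (λ v → f≗g (x ∷ v)))

    ∑V-mono-≤ : ∀ r {f g : Vec (Fin q) r → ℕ} → (∀ v → f v ≤ g v) → ∑V r f ≤ ∑V r g
    ∑V-mono-≤ zero    f≤g = f≤g []
    ∑V-mono-≤ (suc r) f≤g = ∑-mono-≤ q (λ x → ∑V-mono-≤ r (λ v → f≤g (x ∷ v)))

    ∑V-distrib-+ : ∀ r (f g : Vec (Fin q) r → ℕ) → ∑V r (λ v → f v + g v) ≡ ∑V r f + ∑V r g
    ∑V-distrib-+ zero    f g = refl
    ∑V-distrib-+ (suc r) f g =
      trans (∑-cong q (λ x → ∑V-distrib-+ r (λ v → f (x ∷ v)) (λ v → g (x ∷ v)))) (∑-distrib-+ {q} _ _)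

    ∑V-*ˡ : ∀ r c (f : Vec (Fin q) r → ℕ) → ∑V r (λ v → c * f v) ≡ c * ∑V r f
    ∑V-*ˡ zero    c f = refl
    ∑V-*ˡ (suc r) c f = trans (∑-cong q (λ x → ∑V-*ˡ r c (λ v → f (x ∷ v)))) (∑-*ˡ q c _)

    ∑V-*ʳ : ∀ r c (f : Vec (Fin q) r → ℕ) → ∑V r (λ v → f v * c) ≡ ∑V r f * c
    ∑V-*ʳ r c f = trans (∑V-cong r (λ v → *-comm (f v) c)) (trans (∑V-*ˡ r c f) (*-comm c _))

    ∑V-const : ∀ r c → ∑V r (λ _ → c) ≡ q ^ r * c
    ∑V-const zero    c = sym (+-identityʳ c)
    ∑V-const (suc r) c =
      trans (∑-cong q (λ x → ∑V-const r c)) (trans (∑-const q (q ^ r * c)) (sym (*-assoc q (q ^ r) c)))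

    ∑V-zero : ∀ r {f : Vec (Fin q) r → ℕ} → (∀ v → f v ≡ 0) → ∑V r f ≡ 0
    ∑V-zero r f≗0 = trans (∑V-cong r f≗0) (trans (∑V-const r 0) (*-zeroʳ (q ^ r)))

    ∑V-comm : ∀ r k (f : Vec (Fin q) r → Fin k → ℕ) →
              ∑V r (λ v → sum (f v)) ≡ ∑[ i < k ] ∑V r (λ v → f v i)
    ∑V-comm zero    k f = refl
    ∑V-comm (suc r) k f =
      trans (∑-cong q (λ x → ∑V-comm r k (λ v → f (x ∷ v)))) (∑-comm {q} {k} _)

    ∑V-single : ∀ r {f : Vec (Fin q) r → ℕ} v₀ → (∀ v → v ≢ v₀ → f v ≡ 0) → ∑V r f ≡ f v₀
    ∑V-single zero    []        f≡0 = refl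
    ∑V-single (suc r) (x₀ ∷ v₀) f≡0 =
      trans (∑-single q x₀ (λ x x≢x₀ → ∑V-zero r (λ v → f≡0 (x ∷ v) (x≢x₀ ∘ Vecₚ.∷-injectiveˡ))))
            (∑V-single r v₀ (λ v v≢v₀ → f≡0 (x₀ ∷ v) (v≢v₀ ∘ Vecₚ.∷-injectiveʳ)))

    ∑V-≤-tight : ∀ r {f g : Vec (Fin q) r → ℕ} → (∀ v → f v ≤ g v) → ∑V r g ≤ ∑V r f →
                 ∀ v → f v ≡ g v
    ∑V-≤-tight zero    f≤g Σg≤Σf [] = ≤-antisym (f≤g []) Σg≤Σf
    ∑V-≤-tight (suc r) f≤g Σg≤Σf (x ∷ v) =
      ∑V-≤-tight r (λ w → f≤g (x ∷ w)) (≤-reflexive (sym (slice≡ x))) v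
      where
      slice≡ = ∑-≤-tight q (λ y → ∑V-mono-≤ r (λ w → f≤g (y ∷ w))) Σg≤Σf

    ∑V-𝟙-+-not : ∀ r (b : Vec (Fin q) r → Bool) →
                 ∑V r (λ v → 𝟙 (b v)) + ∑V r (λ v → 𝟙 (not (b v))) ≡ q ^ r
    ∑V-𝟙-+-not r b = begin
      ∑V r (λ v → 𝟙 (b v)) + ∑V r (λ v → 𝟙 (not (b v)))  ≡⟨ ∑V-distrib-+ r _ _ ⟨
      ∑V r (λ v → 𝟙 (b v) + 𝟙 (not (b v)))              ≡⟨ ∑V-cong r (λ v → 𝟙-+-not (b v)) ⟩
      ∑V r (λ _ → 1)                                    ≡⟨ trans (∑V-const r 1) (*-identityʳ _) ⟩
      q ^ r                                             ∎
      where open ≡-Reasoning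

  𝟙-inclusion-exclusion : ∀ b c → 𝟙 (not b) * 𝟙 (not c) + (𝟙 b + 𝟙 c) ≡ 1 + 𝟙 b * 𝟙 c
  𝟙-inclusion-exclusion true  true  = refl
  𝟙-inclusion-exclusion true  false = refl
  𝟙-inclusion-exclusion false true  = refl
  𝟙-inclusion-exclusion false false = refl

  Vec-ext : ∀ {A : Set} {r} {v v′ : Vec A r} → (∀ j → lookup v j ≡ lookup v′ j) → v ≡ v′
  Vec-ext {v = v} {v′} v≗v′ =
    trans (sym (Vecₚ.tabulate∘lookup v)) (trans (Vecₚ.tabulate-cong v≗v′) (Vecₚ.tabulate∘lookup v′))

  private
    split-injective-≤ : ∀ {a R a′ R′ B X} → X < B → a ≤ a′ → a + R ≡ a′ + R′ →
                        a * B + R * X ≡ a′ * B + R′ * X → a ≡ a′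
    split-injective-≤ {a} {R} {a′} {R′} {B} {X} X<B a≤a′ sizes weights with m≤n⇒∃[o]m+o≡n a≤a′
    ... | zero  , refl = sym (+-identityʳ a)
    ... | suc d , refl = ⊥-elim (<⇒≢ (*-monoʳ-< (suc d) X<B) (+-cancelˡ-≡ (a * B + R′ * X) _ _ (begin
      a * B + R′ * X + suc d * X  ≡⟨ expand₁ a R′ (suc d) B X ⟩
      a * B + (R′ + suc d) * X    ≡⟨ cong (λ R″ → a * B + R″ * X) R≡R′+d ⟨
      a * B + R * X               ≡⟨ weights ⟩
      (a + suc d) * B + R′ * X    ≡⟨ expand₂ a R′ (suc d) B X ⟩
      a * B + R′ * X + suc d * B  ∎)))
      where
      open ≡-Reasoning
      R≡R′+d : R ≡ R′ + suc d
      R≡R′+d = +-cancelˡ-≡ a _ _ (trans sizes (trans (+-assoc a (suc d) R′) (cong (a +_) (+-comm (suc d) R′))))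
      expand₁ : ∀ a R′ d B X → a * B + R′ * X + d * X ≡ a * B + (R′ + d) * X
      expand₁ = solve-∀
      expand₂ : ∀ a R′ d B X → (a + d) * B + R′ * X ≡ a * B + R′ * X + d * B
      expand₂ = solve-∀

  split-injective : ∀ {a R a′ R′ B X} → X < B → a + R ≡ a′ + R′ →
                    a * B + R * X ≡ a′ * B + R′ * X → a ≡ a′
  split-injective {a} {a′ = a′} X<B sizes weights with ≤-total a a′
  ... | inj₁ a≤a′ = split-injective-≤ X<B a≤a′ sizes weights
  ... | inj₂ a′≤a = sym (split-injective-≤ X<B a′≤a (sym sizes) (sym weights))

open NatSums

private variable
  ℓ : Level
  A : Set ℓ

does-true⇒ : (a? : Dec A) → does a? ≡ true → A
does-true⇒ (yes a) _ = a

does-false⇒ : (a? : Dec A) → does a? ≡ false → ¬ A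
does-false⇒ (no ¬a) _ = ¬a

module FieldProperties (F : Field) where

  open CommutativeRing (Field.ring F) public hiding (zero)
  open FieldOps F public using (sumF; IsZeroVec)
  open RingProperties ring public
  open CommSemigroupProperties *-commutativeSemigroup public using (x∙yz≈y∙xz)
  private
    open module ∑ᴿ = SemiringSum semiring
      using () renaming (sum to sumᴿ)
  module ≈-Reasoning = Relation.Binary.Reasoning.Setoid setoid
  open ≈-Reasoning

  sumF≡sumᴿ : ∀ {m} (f : Fin m → Carrier) → sumF f ≡ sumᴿ f
  sumF≡sumᴿ {zero}  f = ≡.refl
  sumF≡sumᴿ {suc m} f = ≡.cong (f zero +_) (sumF≡sumᴿ (f ∘ suc))

  sumF-cong : ∀ {m} {f g : Fin m → Carrier} → (∀ i → f i ≈ g i) → sumF f ≈ sumF g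
  sumF-cong {m} {f} {g} f≈g = begin
    sumF f  ≡⟨ sumF≡sumᴿ f ⟩
    sumᴿ f  ≈⟨ ∑ᴿ.sum-cong-≋ f≈g ⟩
    sumᴿ g  ≡⟨ sumF≡sumᴿ g ⟨
    sumF g  ∎

  sumF-distrib-+ : ∀ {m} (f g : Fin m → Carrier) → sumF (λ i → f i + g i) ≈ sumF f + sumF g
  sumF-distrib-+ {m} f g = begin
    sumF (λ i → f i + g i) ≡⟨ sumF≡sumᴿ (λ i → f i + g i) ⟩
    sumᴿ (λ i → f i + g i)  ≈⟨ ∑ᴿ.∑-distrib-+ {m} f g ⟩
    sumᴿ f + sumᴿ g          ≡⟨ ≡.cong₂ _+_ (sumF≡sumᴿ f) (sumF≡sumᴿ g) ⟨
    sumF f + sumF g        ∎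

  sumF-*ˡ : ∀ {m} c (f : Fin m → Carrier) → sumF (λ i → c * f i) ≈ c * sumF f
  sumF-*ˡ c f = begin
    sumF (λ i → c * f i) ≡⟨ sumF≡sumᴿ (λ i → c * f i) ⟩
    sumᴿ (λ i → c * f i)  ≈⟨ ∑ᴿ.*-distribˡ-sum c f ⟨
    c * sumᴿ f            ≡⟨ ≡.cong (c *_) (sumF≡sumᴿ f) ⟨
    c * sumF f           ∎

  sumF-*ʳ : ∀ {m} c (f : Fin m → Carrier) → sumF (λ i → f i * c) ≈ sumF f * c
  sumF-*ʳ c f = trans (sumF-cong (λ i → *-comm (f i) c)) (trans (sumF-*ˡ c f) (*-comm c _))

  sumF-comm : ∀ {m k} (f : Fin m → Fin k → Carrier) →
              sumF (λ i → sumF (f i)) ≈ sumF (λ j → sumF (λ i → f i j))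
  sumF-comm {m} {k} f = begin
    sumF (λ i → sumF (f i))              ≈⟨ sumF-cong (λ i → reflexive (sumF≡sumᴿ (f i))) ⟩
    sumF (λ i → sumᴿ (f i))              ≡⟨ sumF≡sumᴿ (λ i → sumᴿ (f i)) ⟩
    sumᴿ (λ i → sumᴿ (f i))                ≈⟨ ∑ᴿ.∑-comm {m} {k} f ⟩
    sumᴿ (λ j → sumᴿ (λ i → f i j))      ≡⟨ sumF≡sumᴿ (λ j → sumᴿ (λ i → f i j)) ⟨
    sumF (λ j → sumᴿ (λ i → f i j))       ≈⟨ sumF-cong (λ j → reflexive (sumF≡sumᴿ (λ i → f i j))) ⟨
    sumF (λ j → sumF (λ i → f i j))      ∎

  sumF-zero : ∀ {m} {f : Fin m → Carrier} → (∀ i → f i ≈ 0#) → sumF f ≈ 0#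
  sumF-zero {m} {f} f≈0 = begin
    sumF f               ≈⟨ sumF-cong f≈0 ⟩
    sumF {m} (λ _ → 0#)  ≡⟨ sumF≡sumᴿ {m} (λ _ → 0#) ⟩
    sumᴿ {m} (λ _ → 0#)  ≈⟨ ∑ᴿ.sum-replicate-zero m ⟩
    0#                   ∎

  sumF-single : ∀ {m} {f : Fin m → Carrier} i₀ → (∀ i → i ≢ i₀ → f i ≈ 0#) → sumF f ≈ f i₀
  sumF-single {suc m} zero      f≈0 = trans (+-congˡ (sumF-zero (λ i → f≈0 (suc i) λ ()))) (+-identityʳ _)
  sumF-single {suc m} (suc i₀) f≈0 =
    trans (+-cong (f≈0 zero λ ()) (sumF-single i₀ (λ i i≢i₀ → f≈0 (suc i) (i≢i₀ ∘ Finₚ.suc-injective))))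
          (+-identityˡ _)

  sumF-neg : ∀ {m} (f : Fin m → Carrier) → sumF (λ i → - f i) ≈ - sumF f
  sumF-neg f = begin
    sumF (λ i → - f i)       ≈⟨ sumF-cong (λ i → sym (-1*x≈-x (f i))) ⟩
    sumF (λ i → - 1# * f i)  ≈⟨ sumF-*ˡ (- 1#) f ⟩
    - 1# * sumF f            ≈⟨ -1*x≈-x _ ⟩
    - sumF f                 ∎

  x*a≈0⇒x≈0 : ∀ {x a} → ¬ a ≈ 0# → x * a ≈ 0# → x ≈ 0#
  x*a≈0⇒x≈0 {x} {a} a≉0 xa≈0 with Field.inv F a a≉0
  ... | b , ab≈1 = begin
    x            ≈⟨ *-identityʳ x ⟨
    x * 1#       ≈⟨ *-congˡ ab≈1 ⟨
    x * (a * b)  ≈⟨ *-assoc x a b ⟨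
    x * a * b    ≈⟨ *-congʳ xa≈0 ⟩
    0# * b       ≈⟨ zeroˡ b ⟩
    0#           ∎

  *-cancelʳ-≉0 : ∀ {x y a} → ¬ a ≈ 0# → x * a ≈ y * a → x ≈ y
  *-cancelʳ-≉0 {x} {y} {a} a≉0 xa≈ya =
    x∙y⁻¹≈ε⇒x≈y x y (x*a≈0⇒x≈0 a≉0 (trans ([y-z]x≈yx-zx a x y) (x≈y⇒x∙y⁻¹≈ε xa≈ya)))

  a+b≈c⇔b≈c-a : ∀ {a b c} → a + b ≈ c ⇔ b ≈ c - a
  a+b≈c⇔b≈c-a {a} {b} {c} = mk⇔
    (λ a+b≈c → trans (sym (xyx⁻¹≈y a b)) (+-congʳ a+b≈c))
    (λ b≈c-a → +-cancelʳ (- a) (a + b) c (trans (xyx⁻¹≈y a b) b≈c-a))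

  a+b≈c⇔a≈c-b : ∀ {a b c} → a + b ≈ c ⇔ a ≈ c - b
  a+b≈c⇔a≈c-b {a} {b} {c} = mk⇔
    (λ a+b≈c → Equivalence.to a+b≈c⇔b≈c-a (trans (+-comm b a) a+b≈c))
    (λ a≈c-b → trans (+-comm a b) (Equivalence.from a+b≈c⇔b≈c-a a≈c-b))

  x≈y⇔x-z≈y-z : ∀ {x y z} → x ≈ y ⇔ x - z ≈ y - z
  x≈y⇔x-z≈y-z {x} {y} {z} = mk⇔ +-congʳ (+-cancelʳ (- z) x y)

  Nonzero : ∀ {r} → (Fin r → Carrier) → Set
  Nonzero w = ∃ λ j → ¬ w j ≈ 0#

  Proportional : ∀ {r} → (Fin r → Carrier) → (Fin r → Carrier) → Set
  Proportional u v = ∃ λ l → ∀ j → v j ≈ l * u j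

  Proportional-sym : ∀ {r} {u v : Fin r → Carrier} → Nonzero v → Proportional u v → Proportional v u
  Proportional-sym {u = u} {v} (j₀ , vj₀≉0) (l , v≈lu) = l⁻¹ , λ j → sym (begin
    l⁻¹ * v j        ≈⟨ *-congˡ (v≈lu j) ⟩
    l⁻¹ * (l * u j)  ≈⟨ *-assoc l⁻¹ l (u j) ⟨
    l⁻¹ * l * u j    ≈⟨ *-congʳ (trans (*-comm l⁻¹ l) ll⁻¹≈1) ⟩
    1# * u j         ≈⟨ *-identityˡ (u j) ⟩
    u j              ∎)
    where
    l≉0 : ¬ l ≈ 0#
    l≉0 l≈0 = vj₀≉0 (trans (v≈lu j₀) (trans (*-congʳ l≈0) (zeroˡ _)))
    l⁻¹ = proj₁ (Field.inv F l l≉0)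
    ll⁻¹≈1 = proj₂ (Field.inv F l l≉0)

  infix 7 _·_
  _·_ : ∀ {r} → (Fin r → Carrier) → (Fin r → Carrier) → Carrier
  b · w = sumF (λ j → b j * w j)

  ·-cong : ∀ {r} {b b′ w w′ : Fin r → Carrier} →
           (∀ j → b j ≈ b′ j) → (∀ j → w j ≈ w′ j) → b · w ≈ b′ · w′
  ·-cong b≈b′ w≈w′ = sumF-cong (λ j → *-cong (b≈b′ j) (w≈w′ j))

  ·-comm : ∀ {r} (b w : Fin r → Carrier) → b · w ≈ w · b
  ·-comm b w = sumF-cong (λ j → *-comm (b j) (w j))

  ·-zeroʳ : ∀ {r} (b : Fin r → Carrier) {w : Fin r → Carrier} → (∀ j → w j ≈ 0#) → b · w ≈ 0#
  ·-zeroʳ b w≈0 = sumF-zero (λ j → trans (*-congˡ (w≈0 j)) (zeroʳ (b j)))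

  ·-*ʳ : ∀ {r} (b w : Fin r → Carrier) l → b · (λ j → l * w j) ≈ l * (b · w)
  ·-*ʳ b w l = trans (sumF-cong (λ j → x∙yz≈y∙xz (b j) l (w j))) (sumF-*ˡ l (λ j → b j * w j))

  ·-distrib-−ˡ : ∀ {r} (a a′ w : Fin r → Carrier) → (λ j → a j - a′ j) · w ≈ a · w - a′ · w
  ·-distrib-−ˡ a a′ w = begin
    sumF (λ j → (a j - a′ j) * w j)         ≈⟨ sumF-cong (λ j → [y-z]x≈yx-zx (w j) (a j) (a′ j)) ⟩
    sumF (λ j → a j * w j - a′ j * w j)     ≈⟨ sumF-distrib-+ (λ j → a j * w j) (λ j → - (a′ j * w j)) ⟩
    a · w + sumF (λ j → - (a′ j * w j))     ≈⟨ +-congˡ (sumF-neg (λ j → a′ j * w j)) ⟩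
    a · w - a′ · w                          ∎

  ·-distrib-−ʳ : ∀ {r} (b w w′ : Fin r → Carrier) → b · (λ j → w j - w′ j) ≈ b · w - b · w′
  ·-distrib-−ʳ b w w′ =
    trans (·-comm b _) (trans (·-distrib-−ˡ w w′ b) (+-cong (·-comm w b) (-‿cong (·-comm w′ b))))

  ·-linearʳ : ∀ {r m} (b : Fin r → Carrier) (c : Fin m → Carrier) (w : Fin m → Fin r → Carrier) →
              b · (λ j → sumF (λ i → c i * w i j)) ≈ sumF (λ i → c i * (b · w i))
  ·-linearʳ b c w = begin
    sumF (λ j → b j * sumF (λ i → c i * w i j))   ≈⟨ sumF-cong (λ j → sumF-*ˡ (b j) (λ i → c i * w i j)) ⟨
    sumF (λ j → sumF (λ i → b j * (c i * w i j))) ≈⟨ sumF-comm (λ i j → b j * (c i * w i j)) ⟨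
    sumF (λ i → sumF (λ j → b j * (c i * w i j))) ≈⟨ sumF-cong (λ i → sumF-cong (λ j → x∙yz≈y∙xz (b j) (c i) (w i j))) ⟩
    sumF (λ i → sumF (λ j → c i * (b j * w i j))) ≈⟨ sumF-cong (λ i → sumF-*ˡ (c i) (λ j → b j * w i j)) ⟩
    sumF (λ i → c i * (b · w i))                  ∎

module FiniteField (F : Field) {q : ℕ} (order : FieldOps.HasOrder F q) where

  open FieldProperties F public
  open VecSum q public

  enum : Fin q → Carrier
  enum = proj₁ order

  code : Carrier → Fin q
  code x = proj₁ (proj₁ (proj₂ order) x)

  enum-code : ∀ x → enum (code x) ≈ x
  enum-code x = proj₂ (proj₁ (proj₂ order) x)

  enum-injective : ∀ i j → enum i ≈ enum j → i ≡ j
  enum-injective = proj₂ (proj₂ order)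

  infix 4 _≈?_ _≈ᵇ_
  _≈?_ : ∀ x y → Dec (x ≈ y)
  x ≈? y with code x Finₚ.≟ code y
  ... | yes cx≡cy = yes (trans (sym (enum-code x)) (trans (reflexive (≡.cong enum cx≡cy)) (enum-code y)))
  ... | no  cx≢cy = no (λ x≈y → cx≢cy (enum-injective _ _ (trans (enum-code x) (trans x≈y (sym (enum-code y))))))

  _≈ᵇ_ : Carrier → Carrier → Bool
  x ≈ᵇ y = does (x ≈? y)

  ≈⇒≈ᵇ : ∀ {x y} → x ≈ y → (x ≈ᵇ y) ≡ true
  ≈⇒≈ᵇ {x} {y} = dec-true (x ≈? y)

  ≉⇒≈ᵇ : ∀ {x y} → ¬ x ≈ y → (x ≈ᵇ y) ≡ false
  ≉⇒≈ᵇ {x} {y} = dec-false (x ≈? y)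

  ≈ᵇ⇒≈ : ∀ {x y} → (x ≈ᵇ y) ≡ true → x ≈ y
  ≈ᵇ⇒≈ {x} {y} = does-true⇒ (x ≈? y)

  ≈ᵇ-⇔ : ∀ {x y x′ y′} → x ≈ y ⇔ x′ ≈ y′ → (x ≈ᵇ y) ≡ (x′ ≈ᵇ y′)
  ≈ᵇ-⇔ {x} {y} {x′} {y′} eq = does-⇔ eq (x ≈? y) (x′ ≈? y′)

  ≈ᵇ-cong : ∀ {x y x′ y′} → x ≈ x′ → y ≈ y′ → (x ≈ᵇ y) ≡ (x′ ≈ᵇ y′)
  ≈ᵇ-cong x≈x′ y≈y′ = ≈ᵇ-⇔ (mk⇔ (λ x≈y → trans (sym x≈x′) (trans x≈y y≈y′))
                               (λ x′≈y′ → trans x≈x′ (trans x′≈y′ (sym y≈y′))))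

  nonzero? : ∀ {r} (w : Fin r → Carrier) → Dec (Nonzero w)
  nonzero? w = Finₚ.any? (λ j → ¬? (w j ≈? 0#))

  ¬Nonzero⇒≈0 : ∀ {r} {w : Fin r → Carrier} → ¬ Nonzero w → ∀ j → w j ≈ 0#
  ¬Nonzero⇒≈0 {w = w} w≡0 j = decidable-stable (w j ≈? 0#) (w≡0 ∘ (j ,_))

  isZero? : ∀ {r} (w : Fin r → Carrier) → Dec (IsZeroVec w)
  isZero? w = Finₚ.all? (λ j → w j ≈? 0#)

  -- Vectors of F^r are enumerated through their coordinate codes, as elements of Vec (Fin q) r.
  ev : ∀ {r} → Vec (Fin q) r → Fin r → Carrier
  ev v j = enum (lookup v j)

  codeV : ∀ {r} → (Fin r → Carrier) → Vec (Fin q) r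
  codeV w = tabulate (code ∘ w)

  ev-codeV : ∀ {r} (w : Fin r → Carrier) j → ev (codeV w) j ≈ w j
  ev-codeV w j = trans (reflexive (≡.cong enum (Vecₚ.lookup∘tabulate (code ∘ w) j))) (enum-code (w j))

  codeV-unique : ∀ {r} (v : Vec (Fin q) r) (w : Fin r → Carrier) → (∀ j → ev v j ≈ w j) → v ≡ codeV w
  codeV-unique v w v≈w = Vec-ext (λ j → enum-injective _ _ (trans (v≈w j) (sym (ev-codeV w j))))

  dot : ∀ {r} → Vec (Fin q) r → (Fin r → Carrier) → Carrier
  dot v w = ev v · w

  unique-solution : ∀ {a} → ¬ a ≈ 0# → ∀ c → ∑[ x < q ] 𝟙 (enum x * a ≈ᵇ c) ≡ 1
  unique-solution {a} a≉0 c with Field.inv F a a≉0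
  ... | b , ab≈1 = ≡.trans (∑-single q x₀ (λ x x≢x₀ → ≡.cong 𝟙 (≉⇒≈ᵇ (x≢x₀ ∘ other x))))
                           (≡.cong 𝟙 (≈⇒≈ᵇ x₀-solves))
    where
    open ≈-Reasoning
    x₀ = code (c * b)
    x₀-solves : enum x₀ * a ≈ c
    x₀-solves = begin
      enum x₀ * a  ≈⟨ *-congʳ (enum-code (c * b)) ⟩
      c * b * a    ≈⟨ *-assoc c b a ⟩
      c * (b * a)  ≈⟨ *-congˡ (trans (*-comm b a) ab≈1) ⟩
      c * 1#       ≈⟨ *-identityʳ c ⟩
      c            ∎
    other : ∀ x → enum x * a ≈ c → x ≡ x₀
    other x xa≈c = enum-injective _ _ (*-cancelʳ-≉0 a≉0 (trans xa≈c (sym x₀-solves)))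

  count-hyperplane : ∀ r (w : Fin (suc r) → Carrier) → Nonzero w → ∀ c →
                     ∑V (suc r) (λ v → 𝟙 (dot v w ≈ᵇ c)) ≡ q ^ r
  count-hyperplane zero w (zero , w₀≉0) c =
    ≡.trans (∑-cong q (λ x → ≡.cong 𝟙 (≈ᵇ-cong (+-identityʳ (enum x * w zero)) (refl {c})))) (unique-solution w₀≉0 c)
  count-hyperplane (suc r) w w≢0 c with nonzero? (w ∘ suc)
  ... | yes tail≢0 = ≡.trans (∑-cong q λ x → ≡.trans
          (∑V-cong (suc r) (λ v → ≡.cong 𝟙 (≈ᵇ-⇔ {x′ = dot v (w ∘ suc)} {c - enum x * w zero} a+b≈c⇔b≈c-a)))
          (count-hyperplane r (w ∘ suc) tail≢0 (c - enum x * w zero)))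
        (∑-const q (q ^ r))
  ... | no tail≡0 = ≡.trans (∑-cong q λ x → ≡.trans
          (∑V-cong (suc r) (λ v → ≡.cong 𝟙 (≈ᵇ-cong (head-only x v) (refl {c}))))
          (∑V-const (suc r) (𝟙 (enum x * w zero ≈ᵇ c))))
        (≡.trans (∑-*ˡ q (q ^ suc r) _)
                 (≡.trans (≡.cong (q ^ suc r ℕ.*_) (unique-solution w₀≉0 c)) (ℕₚ.*-identityʳ _)))
    where
    head-only : ∀ x v → dot (x ∷ v) w ≈ enum x * w zero
    head-only x v = trans (+-congˡ (·-zeroʳ (ev v) (¬Nonzero⇒≈0 tail≡0))) (+-identityʳ _)
    w₀≉0 : ¬ w zero ≈ 0#
    w₀≉0 = head≉0 w≢0
      where
      head≉0 : Nonzero w → ¬ w zero ≈ 0#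
      head≉0 (zero  , w₀≉0) = w₀≉0
      head≉0 (suc j , wj≉0) = ⊥-elim (wj≉0 (¬Nonzero⇒≈0 tail≡0 j))

  dot-head≈0 : ∀ {r} (w : Fin (suc r) → Carrier) → w zero ≈ 0# → ∀ x a → dot (x ∷ a) w ≈ dot a (w ∘ suc)
  dot-head≈0 w w₀≈0 x a = trans (+-congʳ (trans (*-congˡ w₀≈0) (zeroʳ _))) (+-identityˡ _)

  Nonzero-tail : ∀ {r} {w : Fin (suc r) → Carrier} → w zero ≈ 0# → Nonzero w → Nonzero (w ∘ suc)
  Nonzero-tail w₀≈0 (zero  , w₀≉0) = ⊥-elim (w₀≉0 w₀≈0)
  Nonzero-tail w₀≈0 (suc j , wj≉0) = j , wj≉0

  ¬Proportional-tail : ∀ {r} {u v : Fin (suc r) → Carrier} → u zero ≈ 0# → v zero ≈ 0# →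
                       ¬ Proportional u v → ¬ Proportional (u ∘ suc) (v ∘ suc)
  ¬Proportional-tail u₀≈0 v₀≈0 u≁v (l , v≈lu) = u≁v (l , λ
    { zero    → trans v₀≈0 (sym (trans (*-congˡ u₀≈0) (zeroʳ l)))
    ; (suc j) → v≈lu j })

  Proportional-Fin1 : ∀ {u v : Fin 1 → Carrier} → Nonzero u → Proportional u v
  Proportional-Fin1 {u} {v} (zero , u₀≉0) with Field.inv F (u zero) u₀≉0
  ... | u₀⁻¹ , u₀u₀⁻¹≈1 = v zero * u₀⁻¹ , λ { zero → sym (begin
    v zero * u₀⁻¹ * u zero    ≈⟨ *-assoc (v zero) u₀⁻¹ (u zero) ⟩
    v zero * (u₀⁻¹ * u zero)  ≈⟨ *-congˡ (trans (*-comm u₀⁻¹ (u zero)) u₀u₀⁻¹≈1) ⟩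
    v zero * 1#               ≈⟨ *-identityʳ (v zero) ⟩
    v zero                    ∎) }
    where open ≈-Reasoning

  #solutions₂ : ∀ {r} → (Fin r → Carrier) → Carrier → (Fin r → Carrier) → Carrier → ℕ
  #solutions₂ {r} u c v d = ∑V r (λ a → 𝟙 (dot a u ≈ᵇ c) ℕ.* 𝟙 (dot a v ≈ᵇ d))

  #solutions₂-eliminate : ∀ {r} (u v : Fin r → Carrier) l c d →
    #solutions₂ u c v d ≡ #solutions₂ u c (λ j → v j - l * u j) (d - l * c)
  #solutions₂-eliminate {r} u v l c d = ∑V-cong r same
    where
    same : ∀ a → 𝟙 (dot a u ≈ᵇ c) ℕ.* 𝟙 (dot a v ≈ᵇ d)
               ≡ 𝟙 (dot a u ≈ᵇ c) ℕ.* 𝟙 (dot a (λ j → v j - l * u j) ≈ᵇ d - l * c)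
    same a with dot a u ≈? c
    ... | no  _   = ≡.refl
    ... | yes a·u≈c = ≡.cong (λ b → 𝟙 true ℕ.* 𝟙 b) (≈ᵇ-⇔ (mk⇔
            (λ a·v≈d → trans a·v′ (Equivalence.to x≈y⇔x-z≈y-z a·v≈d))
            (λ a·v′≈d′ → Equivalence.from x≈y⇔x-z≈y-z (trans (sym a·v′) a·v′≈d′))))
      where
      a·v′ : dot a (λ j → v j - l * u j) ≈ dot a v - l * c
      a·v′ = trans (·-distrib-−ʳ (ev a) v (λ j → l * u j))
                   (+-congˡ (-‿cong (trans (·-*ʳ (ev a) u l) (*-congˡ a·u≈c))))

  #solutions₂-split-head : ∀ r (u v : Fin (suc r) → Carrier) → ¬ u zero ≈ 0# → v zero ≈ 0# → ∀ c d →
    #solutions₂ u c v d ≡ ∑V r (λ a → 𝟙 (dot a (v ∘ suc) ≈ᵇ d))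
  #solutions₂-split-head r u v u₀≉0 v₀≈0 c d = begin
    ∑[ x < q ] ∑V r (λ a → 𝟙 (dot (x ∷ a) u ≈ᵇ c) ℕ.* 𝟙 (dot (x ∷ a) v ≈ᵇ d))
      ≡⟨ ∑-cong q (λ x → ∑V-cong r (λ a → ≡.cong₂ ℕ._*_
           (≡.cong 𝟙 (≈ᵇ-⇔ {x′ = x·u₀ x} {c - a·u′ a} a+b≈c⇔a≈c-b))
           (≡.cong 𝟙 (≈ᵇ-cong (dot-head≈0 v v₀≈0 x a) (refl {d}))))) ⟩
    ∑[ x < q ] ∑V r (λ a → 𝟙 (x·u₀ x ≈ᵇ c - a·u′ a) ℕ.* a·v′≈d a)
      ≡⟨ ∑V-comm r q (λ a x → 𝟙 (x·u₀ x ≈ᵇ c - a·u′ a) ℕ.* a·v′≈d a) ⟨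
    ∑V r (λ a → ∑[ x < q ] (𝟙 (x·u₀ x ≈ᵇ c - a·u′ a) ℕ.* a·v′≈d a))
      ≡⟨ ∑V-cong r (λ a → ∑-*ʳ q (a·v′≈d a) (λ x → 𝟙 (x·u₀ x ≈ᵇ c - a·u′ a))) ⟩
    ∑V r (λ a → (∑[ x < q ] 𝟙 (x·u₀ x ≈ᵇ c - a·u′ a)) ℕ.* a·v′≈d a)
      ≡⟨ ∑V-cong r (λ a → ≡.trans (≡.cong (ℕ._* a·v′≈d a) (unique-solution u₀≉0 (c - a·u′ a)))
                                  (ℕₚ.*-identityˡ (a·v′≈d a))) ⟩
    ∑V r a·v′≈d ∎
    where
    open ≡.≡-Reasoning
    x·u₀ = λ x → enum x * u zero
    a·u′ = λ a → dot a (u ∘ suc)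
    a·v′≈d = λ a → 𝟙 (dot a (v ∘ suc) ≈ᵇ d)

  count-two-hyperplanes-head : ∀ k (u v : Fin (suc (suc k)) → Carrier) → ¬ u zero ≈ 0# →
    ¬ Proportional u v → ∀ c d → #solutions₂ u c v d ≡ q ^ k
  count-two-hyperplanes-head k u v u₀≉0 u≁v c d with Field.inv F (u zero) u₀≉0
  ... | u₀⁻¹ , u₀u₀⁻¹≈1 =
    ≡.trans (#solutions₂-eliminate u v l c d)
    (≡.trans (#solutions₂-split-head (suc k) u v′ u₀≉0 v′₀≈0 c (d - l * c))
             (count-hyperplane k (v′ ∘ suc) v′-tail≢0 (d - l * c)))
    where
    open ≈-Reasoning
    l = v zero * u₀⁻¹
    v′ = λ j → v j - l * u j
    v′₀≈0 : v′ zero ≈ 0#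
    v′₀≈0 = x≈y⇒x∙y⁻¹≈ε (sym (begin
      l * u zero                 ≈⟨ *-assoc (v zero) u₀⁻¹ (u zero) ⟩
      v zero * (u₀⁻¹ * u zero)   ≈⟨ *-congˡ (trans (*-comm u₀⁻¹ (u zero)) u₀u₀⁻¹≈1) ⟩
      v zero * 1#                ≈⟨ *-identityʳ (v zero) ⟩
      v zero                     ∎))
    v′-tail≢0 : Nonzero (v′ ∘ suc)
    v′-tail≢0 with nonzero? (v′ ∘ suc)
    ... | yes v′-tail≢0 = v′-tail≢0
    ... | no  v′-tail≡0 = ⊥-elim (u≁v (l , λ
      { zero    → x∙y⁻¹≈ε⇒x≈y _ _ v′₀≈0
      ; (suc j) → x∙y⁻¹≈ε⇒x≈y _ _ (¬Nonzero⇒≈0 v′-tail≡0 j) }))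

  count-two-hyperplanes : ∀ k (u v : Fin (suc (suc k)) → Carrier) → Nonzero u → Nonzero v →
    ¬ Proportional u v → ∀ c d → #solutions₂ u c v d ≡ q ^ k
  count-two-hyperplanes k u v u≢0 v≢0 u≁v c d with u zero ≈? 0# | v zero ≈? 0#
  ... | no u₀≉0 | _ = count-two-hyperplanes-head k u v u₀≉0 u≁v c d
  ... | yes _   | no v₀≉0 =
    ≡.trans (∑V-cong (suc (suc k)) (λ a → ℕₚ.*-comm (𝟙 (dot a u ≈ᵇ c)) (𝟙 (dot a v ≈ᵇ d))))
            (count-two-hyperplanes-head k v u v₀≉0 (u≁v ∘ Proportional-sym u≢0) d c)
  count-two-hyperplanes zero u v u≢0 v≢0 u≁v c d | yes u₀≈0 | yes v₀≈0 =
    ⊥-elim (¬Proportional-tail u₀≈0 v₀≈0 u≁v (Proportional-Fin1 (Nonzero-tail u₀≈0 u≢0)))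
  count-two-hyperplanes (suc k) u v u≢0 v≢0 u≁v c d | yes u₀≈0 | yes v₀≈0 = begin
    ∑[ x < q ] ∑V (suc (suc k)) (λ a → 𝟙 (dot (x ∷ a) u ≈ᵇ c) ℕ.* 𝟙 (dot (x ∷ a) v ≈ᵇ d))
      ≡⟨ ∑-cong q (λ x → ∑V-cong (suc (suc k)) (λ a → ≡.cong₂ ℕ._*_
           (≡.cong 𝟙 (≈ᵇ-cong (dot-head≈0 u u₀≈0 x a) (refl {c})))
           (≡.cong 𝟙 (≈ᵇ-cong (dot-head≈0 v v₀≈0 x a) (refl {d}))))) ⟩
    ∑[ x < q ] #solutions₂ (u ∘ suc) c (v ∘ suc) d
      ≡⟨ ∑-cong q (λ _ → count-two-hyperplanes k (u ∘ suc) (v ∘ suc)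
           (Nonzero-tail u₀≈0 u≢0) (Nonzero-tail v₀≈0 v≢0) (¬Proportional-tail u₀≈0 v₀≈0 u≁v) c d) ⟩
    ∑[ x < q ] (q ^ k)
      ≡⟨ ∑-const q (q ^ k) ⟩
    q ^ suc k ∎
    where open ≡.≡-Reasoning

  isZeroᵇ : ∀ {r} → Vec (Fin q) r → Bool
  isZeroᵇ v = does (isZero? (ev v))

  count-zero-vector : ∀ r → ∑V r (λ v → 𝟙 (isZeroᵇ v)) ≡ 1
  count-zero-vector r = ≡.trans (∑V-single r 0ᵛ (λ v v≢0 → ≡.cong 𝟙 (dec-false (isZero? (ev v)) (v≢0 ∘ only v))))
                                (≡.cong 𝟙 (dec-true (isZero? (ev 0ᵛ)) (ev-codeV (λ _ → 0#))))
    where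
    0ᵛ = codeV {r} (λ _ → 0#)
    only : ∀ v → IsZeroVec (ev v) → v ≡ 0ᵛ
    only v v≈0 = codeV-unique v (λ _ → 0#) v≈0

  count-nonzero-vectors : ∀ r → ∑V r (λ v → 𝟙 (not (isZeroᵇ v))) ℕ.+ 1 ≡ q ^ r
  count-nonzero-vectors r = ≡.trans (ℕₚ.+-comm _ 1)
    (≡.trans (≡.cong (ℕ._+ ∑V r (λ v → 𝟙 (not (isZeroᵇ v)))) (≡.sym (count-zero-vector r))) (∑V-𝟙-+-not r isZeroᵇ))

  count-off-hyperplane : ∀ r (w : Fin (suc r) → Carrier) → Nonzero w →
    ∑V (suc r) (λ a → 𝟙 (not (dot a w ≈ᵇ 0#))) ℕ.+ q ^ r ≡ q ^ suc r
  count-off-hyperplane r w w≢0 = ≡.trans (ℕₚ.+-comm _ (q ^ r))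
    (≡.trans (≡.cong (ℕ._+ ∑V (suc r) (λ a → 𝟙 (not (dot a w ≈ᵇ 0#)))) (≡.sym (count-hyperplane r w w≢0 0#)))
             (∑V-𝟙-+-not (suc r) (λ a → dot a w ≈ᵇ 0#)))

  count-off-two-hyperplanes : ∀ k (u v : Fin (suc (suc k)) → Carrier) → Nonzero u → Nonzero v →
    ¬ Proportional u v →
    ∑V (suc (suc k)) (λ a → 𝟙 (not (dot a u ≈ᵇ 0#)) ℕ.* 𝟙 (not (dot a v ≈ᵇ 0#))) ℕ.+ (q ^ suc k ℕ.+ q ^ suc k)
      ≡ q ^ suc (suc k) ℕ.+ q ^ k
  count-off-two-hyperplanes k u v u≢0 v≢0 u≁v = begin
    ∑V r off₂ ℕ.+ (q ^ suc k ℕ.+ q ^ suc k)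
      ≡⟨ ≡.cong (ℕ._+_ (∑V r off₂)) (≡.sym (≡.cong₂ ℕ._+_ (count-hyperplane (suc k) u u≢0 0#)
                                                          (count-hyperplane (suc k) v v≢0 0#))) ⟩
    ∑V r off₂ ℕ.+ (∑V r (λ a → 𝟙 (on u a)) ℕ.+ ∑V r (λ a → 𝟙 (on v a)))
      ≡⟨ ≡.cong (ℕ._+_ (∑V r off₂)) (∑V-distrib-+ r (λ a → 𝟙 (on u a)) (λ a → 𝟙 (on v a))) ⟨
    ∑V r off₂ ℕ.+ ∑V r (λ a → 𝟙 (on u a) ℕ.+ 𝟙 (on v a))
      ≡⟨ ∑V-distrib-+ r off₂ (λ a → 𝟙 (on u a) ℕ.+ 𝟙 (on v a)) ⟨
    ∑V r (λ a → off₂ a ℕ.+ (𝟙 (on u a) ℕ.+ 𝟙 (on v a)))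
      ≡⟨ ∑V-cong r (λ a → 𝟙-inclusion-exclusion (on u a) (on v a)) ⟩
    ∑V r (λ a → 1 ℕ.+ 𝟙 (on u a) ℕ.* 𝟙 (on v a))
      ≡⟨ ∑V-distrib-+ r (λ _ → 1) (λ a → 𝟙 (on u a) ℕ.* 𝟙 (on v a)) ⟩
    ∑V r (λ _ → 1) ℕ.+ #solutions₂ u 0# v 0#
      ≡⟨ ≡.cong₂ ℕ._+_ (≡.trans (∑V-const r 1) (ℕₚ.*-identityʳ _)) (count-two-hyperplanes k u v u≢0 v≢0 u≁v 0# 0#) ⟩
    q ^ r ℕ.+ q ^ k ∎
    where
    open ≡.≡-Reasoning
    r = suc (suc k)
    on : (Fin r → Carrier) → Vec (Fin q) r → Bool
    on w a = dot a w ≈ᵇ 0#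
    off₂ = λ a → 𝟙 (not (on u a)) ℕ.* 𝟙 (not (on v a))

  nonzeroᵇ : Fin q → Bool
  nonzeroᵇ x = not (enum x ≈ᵇ 0#)

  #nonzero-scalars : ℕ
  #nonzero-scalars = ∑[ x < q ] 𝟙 (nonzeroᵇ x)

  #nonzero-scalars+1≡q : #nonzero-scalars ℕ.+ 1 ≡ q
  #nonzero-scalars+1≡q = ≡.trans (ℕₚ.+-comm #nonzero-scalars 1)
    (≡.trans (≡.cong (ℕ._+ #nonzero-scalars) (≡.sym one-zero)) (∑-𝟙-+-not q (λ x → enum x ≈ᵇ 0#)))
    where
    one-zero : ∑[ x < q ] 𝟙 (enum x ≈ᵇ 0#) ≡ 1
    one-zero = ≡.trans (∑-single q (code 0#) (λ x x≢0 → ≡.cong 𝟙 (≉⇒≈ᵇ (λ x≈0 →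
                          x≢0 (enum-injective _ _ (trans x≈0 (sym (enum-code 0#))))))))
                       (≡.cong 𝟙 (≈⇒≈ᵇ (enum-code 0#)))

  1<q : 1 ℕ.< q
  1<q = distinct⇒1<n (code 0#) (code 1#) (λ c0≡c1 → Field.1≉0 F (sym (begin
      0#             ≈⟨ enum-code 0# ⟨
      enum (code 0#) ≡⟨ ≡.cong enum c0≡c1 ⟩
      enum (code 1#) ≈⟨ enum-code 1# ⟩
      1#             ∎)))
    where
    open ≈-Reasoning
    distinct⇒1<n : ∀ {n} (i j : Fin n) → i ≢ j → 1 ℕ.< n
    distinct⇒1<n {suc zero}    zero zero i≢j = ⊥-elim (i≢j ≡.refl)
    distinct⇒1<n {suc (suc n)} _    _    _   = ℕ.s≤s (ℕ.s≤s ℕ.z≤n)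

  _≟ᵛ_ : ∀ {r} (v w : Vec (Fin q) r) → Dec (v ≡ w)
  _≟ᵛ_ = Vecₚ.≡-dec Finₚ._≟_

  count-vector : ∀ r (w : Vec (Fin q) r) → ∑V r (λ v → 𝟙 (does (v ≟ᵛ w))) ≡ 1
  count-vector r w = ≡.trans (∑V-single r w (λ v v≢w → ≡.cong 𝟙 (dec-false (v ≟ᵛ w) v≢w)))
                             (≡.cong 𝟙 (dec-true (w ≟ᵛ w) ≡.refl))

  -- Every nonzero vector is uniquely a nonzero multiple of one of the points p i.
  module ProjectiveCounting {r m : ℕ} (p : Fin m → Fin r → Carrier) (points : FieldOps.ProjPoints F p) where

    p≢0 : ∀ i → Nonzero (p i)
    p≢0 i with nonzero? (p i)
    ... | yes p≢0 = p≢0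
    ... | no  p≡0 = ⊥-elim (proj₁ points i (¬Nonzero⇒≈0 p≡0))

    multiple : Fin q → Fin m → Vec (Fin q) r
    multiple x i = codeV (λ j → enum x * p i j)

    hits : Vec (Fin q) r → Fin m → Fin q → ℕ
    hits v i x = 𝟙 (nonzeroᵇ x) ℕ.* 𝟙 (does (v ≟ᵛ multiple x i))

    hits≢0⇒ : ∀ v i x → hits v i x ≢ 0 → ¬ enum x ≈ 0# × (∀ j → ev v j ≈ enum x * p i j)
    hits≢0⇒ v i x hits≢0 with enum x ≈? 0# | v ≟ᵛ multiple x i
    ... | yes _   | _        = ⊥-elim (hits≢0 ≡.refl)
    ... | no  _   | no _     = ⊥-elim (hits≢0 ≡.refl)
    ... | no  x≉0 | yes v≡xp = x≉0 , λ j → trans (reflexive (≡.cong (λ u → ev u j) v≡xp)) (ev-codeV _ j)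

    hits-zero-vector : ∀ v → IsZeroVec (ev v) → ∀ i x → hits v i x ≡ 0
    hits-zero-vector v v≈0 i x = decidable-stable (hits v i x ℕₚ.≟ 0) λ hits≢0 →
      let x≉0 , v≈xp = hits≢0⇒ v i x hits≢0 ; j , pij≉0 = p≢0 i in
      pij≉0 (x*a≈0⇒x≈0 x≉0 (trans (*-comm _ _) (trans (sym (v≈xp j)) (v≈0 j))))

    hits-unique : ∀ v {i₀ x₀} → (∀ j → ev v j ≈ enum x₀ * p i₀ j) → ∀ i x → hits v i x ≢ 0 → i ≡ i₀ × x ≡ x₀
    hits-unique v {i₀} {x₀} v≈x₀p i x hits≢0 with hits≢0⇒ v i x hits≢0
    ... | x≉0 , v≈xp with i Finₚ.≟ i₀
    ...   | no i≢i₀ = ⊥-elim (proj₂ (proj₂ points) i i₀ i≢i₀ (x⁻¹ * enum x₀ , pi≈x⁻¹x₀pi₀))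
      where
      open ≈-Reasoning
      x⁻¹ = proj₁ (Field.inv F (enum x) x≉0)
      pi≈x⁻¹x₀pi₀ : ∀ j → p i j ≈ x⁻¹ * enum x₀ * p i₀ j
      pi≈x⁻¹x₀pi₀ j = begin
        p i j                      ≈⟨ *-identityˡ _ ⟨
        1# * p i j                 ≈⟨ *-congʳ (trans (*-comm x⁻¹ (enum x)) (proj₂ (Field.inv F (enum x) x≉0))) ⟨
        x⁻¹ * enum x * p i j       ≈⟨ *-assoc _ _ _ ⟩
        x⁻¹ * (enum x * p i j)     ≈⟨ *-congˡ (trans (sym (v≈xp j)) (v≈x₀p j)) ⟩
        x⁻¹ * (enum x₀ * p i₀ j)   ≈⟨ *-assoc _ _ _ ⟨
        x⁻¹ * enum x₀ * p i₀ j     ∎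
    ...   | yes ≡.refl with p≢0 i
    ...     | j , pij≉0 = ≡.refl , enum-injective _ _ (*-cancelʳ-≉0 pij≉0 (trans (sym (v≈xp j)) (v≈x₀p j)))

    nonzero-hit-once : ∀ v → 𝟙 (not (isZeroᵇ v)) ≡ ∑[ i < m ] ∑[ x < q ] hits v i x
    nonzero-hit-once v with isZeroᵇ v in v≟0
    ... | true = ≡.sym (∑-zero m (λ i → ∑-zero q (hits-zero-vector v (does-true⇒ (isZero? (ev v)) v≟0) i)))
    ... | false with proj₁ (proj₂ points) (ev v) (does-false⇒ (isZero? (ev v)) v≟0)
    ...   | i₀ , a , v≈ap = ≡.sym (≡.trans (∑-single m i₀ other-i) (≡.trans (∑-single q x₀ other-x) at-x₀))
      where
      x₀ = code a
      v≈x₀p : ∀ j → ev v j ≈ enum x₀ * p i₀ j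
      v≈x₀p j = trans (v≈ap j) (*-congʳ (sym (enum-code a)))
      other-i : ∀ i → i ≢ i₀ → ∑[ x < q ] hits v i x ≡ 0
      other-i i i≢i₀ = ∑-zero q (λ x → decidable-stable (hits v i x ℕₚ.≟ 0) (i≢i₀ ∘ proj₁ ∘ hits-unique v v≈x₀p i x))
      other-x : ∀ x → x ≢ x₀ → hits v i₀ x ≡ 0
      other-x x x≢x₀ = decidable-stable (hits v i₀ x ℕₚ.≟ 0) (x≢x₀ ∘ proj₂ ∘ hits-unique v v≈x₀p i₀ x)
      x₀≉0 : ¬ enum x₀ ≈ 0#
      x₀≉0 x₀≈0 = does-false⇒ (isZero? (ev v)) v≟0 (λ j → trans (v≈x₀p j) (trans (*-congʳ x₀≈0) (zeroˡ _)))
      at-x₀ : hits v i₀ x₀ ≡ 1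
      at-x₀ = ≡.cong₂ ℕ._*_ (≡.cong (𝟙 ∘ not) (≉⇒≈ᵇ x₀≉0))
                            (≡.cong 𝟙 (dec-true (v ≟ᵛ multiple x₀ i₀) (codeV-unique v _ v≈x₀p)))

    ∑-projective : (P : (Fin r → Carrier) → Bool) →
      (∀ w w′ → (∀ j → w j ≈ w′ j) → P w ≡ P w′) →
      (∀ l w → ¬ l ≈ 0# → P (λ j → l * w j) ≡ P w) →
      ∑V r (λ v → 𝟙 (not (isZeroᵇ v)) ℕ.* 𝟙 (P (ev v))) ≡ #nonzero-scalars ℕ.* ∑[ i < m ] 𝟙 (P (p i))
    ∑-projective P P-cong P-scale = begin
      ∑V r (λ v → 𝟙 (not (isZeroᵇ v)) ℕ.* 𝟙 (P (ev v)))
        ≡⟨ ∑V-cong r expand ⟩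
      ∑V r (λ v → ∑[ i < m ] ∑[ x < q ] (hits v i x ℕ.* Pᵢ i))
        ≡⟨ ∑V-comm r m (λ v i → ∑[ x < q ] (hits v i x ℕ.* Pᵢ i)) ⟩
      ∑[ i < m ] ∑V r (λ v → ∑[ x < q ] (hits v i x ℕ.* Pᵢ i))
        ≡⟨ ∑-cong m (λ i → ∑V-comm r q (λ v x → hits v i x ℕ.* Pᵢ i)) ⟩
      ∑[ i < m ] ∑[ x < q ] ∑V r (λ v → hits v i x ℕ.* Pᵢ i)
        ≡⟨ ∑-cong m (λ i → ∑-cong q (λ x → count-multiple i x)) ⟩
      ∑[ i < m ] ∑[ x < q ] (𝟙 (nonzeroᵇ x) ℕ.* Pᵢ i)
        ≡⟨ ∑-cong m (λ i → ∑-*ʳ q (Pᵢ i) (λ x → 𝟙 (nonzeroᵇ x))) ⟩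
      ∑[ i < m ] (#nonzero-scalars ℕ.* Pᵢ i)
        ≡⟨ ∑-*ˡ m #nonzero-scalars Pᵢ ⟩
      #nonzero-scalars ℕ.* ∑[ i < m ] Pᵢ i ∎
      where
      open ≡.≡-Reasoning
      Pᵢ = λ i → 𝟙 (P (p i))
      P-at-hit : ∀ v i x → hits v i x ℕ.* 𝟙 (P (ev v)) ≡ hits v i x ℕ.* Pᵢ i
      P-at-hit v i x with hits v i x ℕₚ.≟ 0
      ... | yes hits≡0 rewrite hits≡0 = ≡.refl
      ... | no  hits≢0 with hits≢0⇒ v i x hits≢0
      ...   | x≉0 , v≈xp = ≡.cong (λ b → hits v i x ℕ.* 𝟙 b) (≡.trans (P-cong _ _ v≈xp) (P-scale (enum x) (p i) x≉0))
      expand : ∀ v → 𝟙 (not (isZeroᵇ v)) ℕ.* 𝟙 (P (ev v)) ≡ ∑[ i < m ] ∑[ x < q ] (hits v i x ℕ.* Pᵢ i)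
      expand v = begin
        𝟙 (not (isZeroᵇ v)) ℕ.* 𝟙 (P (ev v))
          ≡⟨ ≡.cong (ℕ._* 𝟙 (P (ev v))) (nonzero-hit-once v) ⟩
        (∑[ i < m ] ∑[ x < q ] hits v i x) ℕ.* 𝟙 (P (ev v))
          ≡⟨ ∑-*ʳ m (𝟙 (P (ev v))) (λ i → ∑[ x < q ] hits v i x) ⟨
        ∑[ i < m ] ((∑[ x < q ] hits v i x) ℕ.* 𝟙 (P (ev v)))
          ≡⟨ ∑-cong m (λ i → ∑-*ʳ q (𝟙 (P (ev v))) (hits v i)) ⟨
        ∑[ i < m ] ∑[ x < q ] (hits v i x ℕ.* 𝟙 (P (ev v)))
          ≡⟨ ∑-cong m (λ i → ∑-cong q (P-at-hit v i)) ⟩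
        ∑[ i < m ] ∑[ x < q ] (hits v i x ℕ.* Pᵢ i) ∎
      count-multiple : ∀ i x → ∑V r (λ v → hits v i x ℕ.* Pᵢ i) ≡ 𝟙 (nonzeroᵇ x) ℕ.* Pᵢ i
      count-multiple i x = begin
        ∑V r (λ v → hits v i x ℕ.* Pᵢ i)
          ≡⟨ ∑V-*ʳ r (Pᵢ i) (λ v → hits v i x) ⟩
        ∑V r (λ v → hits v i x) ℕ.* Pᵢ i
          ≡⟨ ≡.cong (ℕ._* Pᵢ i) (∑V-*ˡ r (𝟙 (nonzeroᵇ x)) (λ v → 𝟙 (does (v ≟ᵛ multiple x i)))) ⟩
        𝟙 (nonzeroᵇ x) ℕ.* ∑V r (λ v → 𝟙 (does (v ≟ᵛ multiple x i))) ℕ.* Pᵢ i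
          ≡⟨ ≡.cong (λ n → 𝟙 (nonzeroᵇ x) ℕ.* n ℕ.* Pᵢ i) (count-vector r (multiple x i)) ⟩
        𝟙 (nonzeroᵇ x) ℕ.* 1 ℕ.* Pᵢ i
          ≡⟨ ≡.cong (ℕ._* Pᵢ i) (ℕₚ.*-identityʳ (𝟙 (nonzeroᵇ x))) ⟩
        𝟙 (nonzeroᵇ x) ℕ.* Pᵢ i ∎

  module _ {m : ℕ} where

    off-two-points : ∀ {r} → (Fin m → Fin r → Carrier) → Fin m → Fin m → ℕ
    off-two-points {r} p i j = ∑V r (λ a → 𝟙 (not (dot a (p i) ≈ᵇ 0#)) ℕ.* 𝟙 (not (dot a (p j) ≈ᵇ 0#)))

    off-two-points-identity : ∀ k (p : Fin m → Fin (suc (suc k)) → Carrier) → FieldOps.ProjPoints F p →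
      ∀ {i j} → i ≢ j → off-two-points p i j ℕ.+ (q ^ suc k ℕ.+ q ^ suc k) ≡ q ^ suc (suc k) ℕ.+ q ^ k
    off-two-points-identity k p points {i} {j} i≢j =
      count-off-two-hyperplanes k (p i) (p j) (p≢0 i) (p≢0 j) (proj₂ (proj₂ points) j i (i≢j ∘ ≡.sym))
      where open ProjectiveCounting p points

    distinct-points-in-PG0 : (p : Fin m → Fin 1 → Carrier) → FieldOps.ProjPoints F p → ∀ {i j} → ¬ i ≢ j
    distinct-points-in-PG0 p points {i} {j} i≢j =
      proj₂ (proj₂ points) i j i≢j (Proportional-Fin1 (ProjectiveCounting.p≢0 p points j))

    off-two-points-constant : ∀ r′ (p : Fin m → Fin (suc r′) → Carrier) → FieldOps.ProjPoints F p →
      ∀ {i j i′ j′} → i ≢ j → i′ ≢ j′ → off-two-points p i j ≡ off-two-points p i′ j′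
    off-two-points-constant zero    p points i≢j _ = ⊥-elim (distinct-points-in-PG0 p points i≢j)
    off-two-points-constant (suc k) p points i≢j i′≢j′ = ℕₚ.+-cancelʳ-≡ _ _ _
      (≡.trans (off-two-points-identity k p points i≢j) (≡.sym (off-two-points-identity k p points i′≢j′)))

    off-two-points< : ∀ r′ (p : Fin m → Fin (suc r′) → Carrier) → FieldOps.ProjPoints F p →
      ∀ {i j} → i ≢ j → off-two-points p i j ℕ.+ q ^ r′ ℕ.< q ^ suc r′
    off-two-points< zero    p points i≢j = ⊥-elim (distinct-points-in-PG0 p points i≢j)
    off-two-points< (suc k) p points {i} {j} i≢j = ℕₚ.+-cancelʳ-< (q ^ suc k) _ _ (begin-strict
      off-two-points p i j ℕ.+ q ^ suc k ℕ.+ q ^ suc k   ≡⟨ ℕₚ.+-assoc (off-two-points p i j) _ _ ⟩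
      off-two-points p i j ℕ.+ (q ^ suc k ℕ.+ q ^ suc k) ≡⟨ off-two-points-identity k p points i≢j ⟩
      q ^ suc (suc k) ℕ.+ q ^ k                          <⟨ ℕₚ.+-monoʳ-< (q ^ suc (suc k)) (ℕₚ.^-monoʳ-< q 1<q (ℕₚ.n<1+n k)) ⟩
      q ^ suc (suc k) ℕ.+ q ^ suc k                      ∎)
      where open ℕₚ.≤-Reasoning

funToFin-cong : ∀ {m n} {f g : Fin m → Fin n} → (∀ i → f i ≡ g i) → funToFin f ≡ funToFin g
funToFin-cong {zero}  f≗g = ≡.refl
funToFin-cong {suc m} f≗g = ≡.cong₂ combine (f≗g zero) (funToFin-cong (f≗g ∘ suc))

module _ {q : ℕ} where

  encodeVec : ∀ {k} → Vec (Fin q) k → Fin (q ^ k)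
  encodeVec v = funToFin (lookup v)

  decodeVec : ∀ k → Fin (q ^ k) → Vec (Fin q) k
  decodeVec k i = tabulate (finToFun {n = k} i)

  encodeVec-injective : ∀ {k} {v w : Vec (Fin q) k} → encodeVec v ≡ encodeVec w → v ≡ w
  encodeVec-injective {v = v} {w} ev≡ew = Vec-ext λ j → ≡.trans (≡.sym (Finₚ.finToFun-funToFin (lookup v) j))
    (≡.trans (≡.cong (λ k → finToFun k j) ev≡ew) (Finₚ.finToFun-funToFin (lookup w) j))

  decodeVec-injective : ∀ k {i j : Fin (q ^ k)} → decodeVec k i ≡ decodeVec k j → i ≡ j
  decodeVec-injective k {i} {j} di≡dj = ≡.trans (≡.sym (Finₚ.funToFin-finToFin {k} i))
    (≡.trans (funToFin-cong (λ l → ≡.trans (≡.sym (Vecₚ.lookup∘tabulate (finToFun {n = k} i) l))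
                                   (≡.trans (≡.cong (λ v → lookup v l) di≡dj) (Vecₚ.lookup∘tabulate (finToFun {n = k} j) l))))
             (Finₚ.funToFin-finToFin {k} j))

  Vec-pigeonhole : ∀ {s t} → 1 ℕ.< q → s ℕ.< t → (h : Vec (Fin q) t → Vec (Fin q) s) →
                   ∃₂ λ a a′ → a ≢ a′ × h a ≡ h a′
  Vec-pigeonhole {s} {t} 1<q s<t h
    with i , j , i<j , hi≡hj ← Finₚ.pigeonhole (ℕₚ.^-monoʳ-< q 1<q s<t) (encodeVec ∘ h ∘ decodeVec t)
    = decodeVec t i , decodeVec t j , Finₚ.<⇒≢ i<j ∘ decodeVec-injective t , encodeVec-injective hi≡hj

size : ∀ {n} → Subset n → ℕ
size []            = 0
size (inside ∷ p)  = suc (size p)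
size (outside ∷ p) = size p

size≡∣∣ : ∀ {n} (p : Subset n) → size p ≡ ∣ p ∣
size≡∣∣ []            = ≡.refl
size≡∣∣ (inside ∷ p)  = ≡.cong suc (size≡∣∣ p)
size≡∣∣ (outside ∷ p) = size≡∣∣ p

element : ∀ {n} (p : Subset n) → Fin (size p) → Fin n
element (inside ∷ p)  zero    = zero
element (inside ∷ p)  (suc k) = suc (element p k)
element (outside ∷ p) k       = suc (element p k)

element-∈ : ∀ {n} (p : Subset n) k → element p k ∈ p
element-∈ (inside ∷ p)  zero    = here
element-∈ (inside ∷ p)  (suc k) = there (element-∈ p k)
element-∈ (outside ∷ p) k       = there (element-∈ p k)

element-injective : ∀ {n} (p : Subset n) k l → element p k ≡ element p l → k ≡ l
element-injective (inside ∷ p)  zero    zero    _ = ≡.refl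
element-injective (inside ∷ p)  (suc k) (suc l) e = ≡.cong suc (element-injective p k l (Finₚ.suc-injective e))
element-injective (outside ∷ p) k       l       e = element-injective p k l (Finₚ.suc-injective e)

element-surjective : ∀ {n} (p : Subset n) x → x ∈ p → ∃ λ k → element p k ≡ x
element-surjective (inside ∷ p)  zero    here      = zero , ≡.refl
element-surjective (inside ∷ p)  (suc x) (there x∈p) with element-surjective p x x∈p
... | k , ≡.refl = suc k , ≡.refl
element-surjective (outside ∷ p) (suc x) (there x∈p) with element-surjective p x x∈p
... | k , ≡.refl = k , ≡.refl

∣p∪⁅x⁆∣≡1+∣p∣ : ∀ {n} (p : Subset n) x → x ∉ p → ∣ p ∪ ⁅ x ⁆ ∣ ≡ suc ∣ p ∣
∣p∪⁅x⁆∣≡1+∣p∣ (inside ∷ p)  zero    x∉p = ⊥-elim (x∉p here)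
∣p∪⁅x⁆∣≡1+∣p∣ (outside ∷ p) zero    x∉p = ≡.cong (suc ∘ ∣_∣) (Subₚ.∪-identityʳ p)
∣p∪⁅x⁆∣≡1+∣p∣ (inside ∷ p)  (suc x) x∉p = ≡.cong suc (∣p∪⁅x⁆∣≡1+∣p∣ p x (x∉p ∘ there))
∣p∪⁅x⁆∣≡1+∣p∣ (outside ∷ p) (suc x) x∉p = ∣p∪⁅x⁆∣≡1+∣p∣ p x (x∉p ∘ there)

module LinearAlgebra (F : Field) {q : ℕ} (order : FieldOps.HasOrder F q)
                     {r m : ℕ} (p : Fin m → Fin r → FieldOps.Carrier F) where

  open FiniteField F order
  open FieldOps F using (LinIndep; VRank)

  LinIndep-extend : ∀ {Y} → LinIndep p Y → (b : Fin r → Carrier) → (∀ y → y ∈ Y → b · p y ≈ 0#) →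
                    ∀ z → ¬ b · p z ≈ 0# → LinIndep p (Y ∪ ⁅ z ⁆)
  LinIndep-extend {Y} Y-indep b b⊥Y z b·z≉0 c c≈0-outside ∑cp≈0 = c≈0-on
    where
    outside-both : ∀ i → i ∉ Y → i ≢ z → i ∉ Y ∪ ⁅ z ⁆
    outside-both i i∉Y i≢z i∈Y∪z with Subₚ.x∈p∪q⁻ Y ⁅ z ⁆ i∈Y∪z
    ... | inj₁ i∈Y = i∉Y i∈Y
    ... | inj₂ i∈z = i≢z (Subₚ.x∈⁅y⁆⇒x≡y z i∈z)
    only-z : ∀ i → i ≢ z → c i * (b · p i) ≈ 0#
    only-z i i≢z with i Subₚ.∈? Y
    ... | yes i∈Y = trans (*-congˡ (b⊥Y i i∈Y)) (zeroʳ (c i))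
    ... | no  i∉Y = trans (*-congʳ (c≈0-outside i (outside-both i i∉Y i≢z))) (zeroˡ _)
    cz≈0 : c z ≈ 0#
    cz≈0 = x*a≈0⇒x≈0 b·z≉0 (trans (sym (sumF-single z only-z))
                                   (trans (sym (·-linearʳ b c p)) (·-zeroʳ b ∑cp≈0)))
    c≈0-outside-Y : ∀ i → i ∉ Y → c i ≈ 0#
    c≈0-outside-Y i i∉Y with i Finₚ.≟ z
    ... | yes ≡.refl = cz≈0
    ... | no  i≢z    = c≈0-outside i (outside-both i i∉Y i≢z)
    c≈0-on : ∀ i → i ∈ Y ∪ ⁅ z ⁆ → c i ≈ 0#
    c≈0-on i i∈Y∪z with Subₚ.x∈p∪q⁻ Y ⁅ z ⁆ i∈Y∪z
    ... | inj₁ i∈Y = Y-indep c c≈0-outside-Y ∑cp≈0 i i∈Y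
    ... | inj₂ i∈z rewrite Subₚ.x∈⁅y⁆⇒x≡y z i∈z = cz≈0

  δ : Fin m → Fin m → Carrier
  δ i i′ with i Finₚ.≟ i′
  ... | yes _ = 1#
  ... | no  _ = 0#

  δ-≢ : ∀ i i′ → i ≢ i′ → δ i i′ ≈ 0#
  δ-≢ i i′ i≢i′ with i Finₚ.≟ i′
  ... | yes i≡i′ = ⊥-elim (i≢i′ i≡i′)
  ... | no  _    = refl

  δ-refl : ∀ i → δ i i ≈ 1#
  δ-refl i with i Finₚ.≟ i
  ... | yes _   = refl
  ... | no  i≢i = ⊥-elim (i≢i ≡.refl)

  -- Coefficients indexed by the elements of Y, extended by zero to all of Fin m.
  spread : (Y : Subset m) → (Fin (size Y) → Carrier) → Fin m → Carrier
  spread Y d i = sumF (λ k → d k * δ (element Y k) i)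

  spread-∉ : ∀ Y d i → i ∉ Y → spread Y d i ≈ 0#
  spread-∉ Y d i i∉Y = sumF-zero (λ k → trans (*-congˡ (δ-≢ (element Y k) i (λ ek≡i →
    i∉Y (≡.subst (_∈ Y) ek≡i (element-∈ Y k))))) (zeroʳ (d k)))

  spread-element : ∀ Y d k → spread Y d (element Y k) ≈ d k
  spread-element Y d k = trans
    (sumF-single k (λ l l≢k →
      trans (*-congˡ (δ-≢ (element Y l) (element Y k) (l≢k ∘ element-injective Y l k))) (zeroʳ (d l))))
    (trans (*-congˡ (δ-refl (element Y k))) (*-identityʳ (d k)))

  ∑-spread : ∀ Y d (w : Fin m → Carrier) → sumF (λ i → spread Y d i * w i) ≈ sumF (λ k → d k * w (element Y k))
  ∑-spread Y d w = begin
    sumF (λ i → spread Y d i * w i)                      ≈⟨ sumF-cong (λ i → sym (sumF-*ʳ (w i) (λ k → d k * δ (e k) i))) ⟩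
    sumF (λ i → sumF (λ k → d k * δ (e k) i * w i))      ≈⟨ sumF-comm (λ i k → d k * δ (e k) i * w i) ⟩
    sumF (λ k → sumF (λ i → d k * δ (e k) i * w i))      ≈⟨ sumF-cong (λ k → sumF-single (e k) (off-diagonal k)) ⟩
    sumF (λ k → d k * δ (e k) (e k) * w (e k))           ≈⟨ sumF-cong (λ k → *-congʳ (trans (*-congˡ (δ-refl (e k))) (*-identityʳ _))) ⟩
    sumF (λ k → d k * w (e k))                           ∎
    where
    open ≈-Reasoning
    e = element Y
    off-diagonal : ∀ k i → i ≢ e k → d k * δ (e k) i * w i ≈ 0#
    off-diagonal k i i≢ek = trans (*-congʳ (trans (*-congˡ (δ-≢ (e k) i (i≢ek ∘ ≡.sym))) (zeroʳ _))) (zeroˡ _)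

  span-code : (Y : Subset m) → Vec (Fin q) (size Y) → Vec (Fin q) r
  span-code Y c = codeV (λ j → sumF (λ k → ev c k * p (element Y k) j))

  -- By pigeonhole two coefficient vectors on Y have the same combination; their difference is a dependency.
  LinIndep⇒∣∣≤r : ∀ {Y} → LinIndep p Y → ∣ Y ∣ ℕ.≤ r
  LinIndep⇒∣∣≤r {Y} Y-indep with ∣ Y ∣ ℕₚ.≤? r
  ... | yes ∣Y∣≤r = ∣Y∣≤r
  ... | no  ∣Y∣≰r with Vec-pigeonhole 1<q (≡.subst (r ℕ.<_) (≡.sym (size≡∣∣ Y)) (ℕₚ.≰⇒> ∣Y∣≰r)) (span-code Y)
  ...   | c , c′ , c≢c′ , same-span = ⊥-elim (c≢c′ (Vec-ext (λ k → enum-injective _ _ (x∙y⁻¹≈ε⇒x≈y _ _ (d≈0 k)))))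
    where
    open ≈-Reasoning
    d : Fin (size Y) → Carrier
    d k = ev c k - ev c′ k
    ∑dp≈0 : ∀ j → sumF (λ i → spread Y d i * p i j) ≈ 0#
    ∑dp≈0 j = trans (∑-spread Y d (λ i → p i j))
      (trans (·-distrib-−ˡ (ev c) (ev c′) (λ k → p (element Y k) j)) (x≈y⇒x∙y⁻¹≈ε (begin
        sumF (λ k → ev c k * p (element Y k) j)   ≈⟨ ev-codeV _ j ⟨
        ev (span-code Y c) j                      ≡⟨ ≡.cong (λ v → ev v j) same-span ⟩
        ev (span-code Y c′) j                     ≈⟨ ev-codeV _ j ⟩
        sumF (λ k → ev c′ k * p (element Y k) j)  ∎)))
    d≈0 : ∀ k → d k ≈ 0#
    d≈0 k = trans (sym (spread-element Y d k))
                  (Y-indep (spread Y d) (spread-∉ Y d) ∑dp≈0 (element Y k) (element-∈ Y k))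

  functional-code : (Y : Subset m) → Vec (Fin q) r → Vec (Fin q) (size Y)
  functional-code Y a = tabulate (λ k → code (dot a (p (element Y k))))

  orthogonal-functional : ∀ {X ρ} → VRank p X ρ → ρ ℕ.< r →
                          ∃ λ b → Nonzero (ev b) × (∀ x → x ∈ X → dot b (p x) ≈ 0#)
  orthogonal-functional {X} {ρ} ((Y , Y⊆X , Y-indep , ∣Y∣≡ρ) , maximal) ρ<r
    with a , a′ , a≢a′ , same-values ← Vec-pigeonhole 1<q (≡.subst (ℕ._< r) (≡.sym (≡.trans (size≡∣∣ Y) ∣Y∣≡ρ)) ρ<r)
                                                       (functional-code Y)
    = b , b≢0 , b⊥X
    where
    open ≈-Reasoning
    b = codeV (λ j → ev a j - ev a′ j)
    b≢0 : Nonzero (ev b)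
    b≢0 with Finₚ.any? (λ j → ¬? (lookup a j Finₚ.≟ lookup a′ j))
    ... | yes (j , aj≢a′j) = j , λ bj≈0 → aj≢a′j (enum-injective _ _ (x∙y⁻¹≈ε⇒x≈y _ _ (trans (sym (ev-codeV _ j)) bj≈0)))
    ... | no  a≗a′        = ⊥-elim (a≢a′ (Vec-ext (λ j → decidable-stable (lookup a j Finₚ.≟ lookup a′ j) (a≗a′ ∘ (j ,_)))))
    dot-b : ∀ w → dot b w ≈ dot a w - dot a′ w
    dot-b w = trans (·-cong {w = w} (ev-codeV (λ j → ev a j - ev a′ j)) (λ _ → refl)) (·-distrib-−ˡ (ev a) (ev a′) w)
    b⊥element : ∀ k → dot b (p (element Y k)) ≈ 0#
    b⊥element k = trans (dot-b _) (x≈y⇒x∙y⁻¹≈ε (begin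
      dot a (p (element Y k))                   ≈⟨ enum-code _ ⟨
      enum (code (dot a (p (element Y k))))     ≡⟨ ≡.cong enum (Vecₚ.lookup∘tabulate _ k) ⟨
      enum (lookup (functional-code Y a) k)     ≡⟨ ≡.cong (λ v → enum (lookup v k)) same-values ⟩
      enum (lookup (functional-code Y a′) k)    ≡⟨ ≡.cong enum (Vecₚ.lookup∘tabulate _ k) ⟩
      enum (code (dot a′ (p (element Y k))))    ≈⟨ enum-code _ ⟩
      dot a′ (p (element Y k))                  ∎))
    b⊥Y : ∀ y → y ∈ Y → dot b (p y) ≈ 0#
    b⊥Y y y∈Y with element-surjective Y y y∈Y
    ... | k , ≡.refl = b⊥element k
    b⊥X : ∀ x → x ∈ X → dot b (p x) ≈ 0#
    b⊥X x x∈X = decidable-stable (dot b (p x) ≈? 0#) λ b·x≉0 →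
      ℕₚ.<-irrefl ≡.refl (≡.subst (ℕ._≤ ρ) (≡.trans (∣p∪⁅x⁆∣≡1+∣p∣ Y x (b·x≉0 ∘ b⊥Y x)) (≡.cong suc ∣Y∣≡ρ))
        (maximal (Y ∪ ⁅ x ⁆) (Y∪x⊆X _) (LinIndep-extend Y-indep (ev b) b⊥Y x b·x≉0)))
      where
      Y∪x⊆X : ∀ z → z ∈ Y ∪ ⁅ x ⁆ → z ∈ X
      Y∪x⊆X z z∈Y∪x with Subₚ.x∈p∪q⁻ Y ⁅ x ⁆ z∈Y∪x
      ... | inj₁ z∈Y = Y⊆X z∈Y
      ... | inj₂ z∈x rewrite Subₚ.x∈⁅y⁆⇒x≡y x z∈x = x∈X

_≟ˢ_ : ∀ {n} (p q : Subset n) → Dec (p ≡ q)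
_≟ˢ_ = Vecₚ.≡-dec Boolₚ._≟_

module MatroidProperties {n : ℕ} (M : Matroid n) where

  open import Data.List using (List; []; _∷_; filter; allFin)
  open import Data.List.Membership.Propositional using () renaming (_∈_ to _∈ˡ_)
  import Data.List.Membership.Propositional.Properties as Listₚ
  open import Data.List.Relation.Unary.Any using (here; there)
  open import Data.Nat using (_+_; _≤_; _<_)
  open import Data.Nat.Properties
  open import Relation.Binary.PropositionalEquality using (refl; sym; trans; cong; subst)
  open Matroid M

  rk⁅⁆≤1 : ∀ e → rk ⁅ e ⁆ ≤ 1
  rk⁅⁆≤1 e = subst (rk ⁅ e ⁆ ≤_) (Subₚ.∣⁅x⁆∣≡1 e) (rk-bound ⁅ e ⁆)

  Loop⇒rk≡0 : ∀ {e} → Loop M e → rk ⁅ e ⁆ ≡ 0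
  Loop⇒rk≡0 {e} (dependent , _) = n≤0⇒n≡0 (≤-pred (subst (rk ⁅ e ⁆ <_) (Subₚ.∣⁅x⁆∣≡1 e) dependent))

  ⊆⁅⁆-cases : ∀ {D : Subset n} {e} → D ⊆ ⁅ e ⁆ → D ≡ ⁅ e ⁆ ⊎ ∣ D ∣ ≡ 0
  ⊆⁅⁆-cases {D} {e} D⊆e with e Subₚ.∈? D
  ... | yes e∈D = inj₁ (Subₚ.⊆-antisym D⊆e (λ x∈e → subst (_∈ D) (sym (Subₚ.x∈⁅y⁆⇒x≡y e x∈e)) e∈D))
  ... | no  e∉D = inj₂ (n≤0⇒n≡0 (subst (∣ D ∣ ≤_) (Subₚ.∣⊥∣≡0 n) (Subₚ.p⊆q⇒∣p∣≤∣q∣ D⊆⊥)))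
    where
    D⊆⊥ : D ⊆ Data.Fin.Subset.⊥
    D⊆⊥ {x} x∈D = ⊥-elim (e∉D (subst (_∈ D) (Subₚ.x∈⁅y⁆⇒x≡y e (D⊆e x∈D)) x∈D))

  rk≡0⇒Loop : ∀ {e} → rk ⁅ e ⁆ ≡ 0 → Loop M e
  rk≡0⇒Loop {e} rk≡0 = dependent , minimal
    where
    dependent : rk ⁅ e ⁆ < ∣ ⁅ e ⁆ ∣
    dependent rewrite rk≡0 | Subₚ.∣⁅x⁆∣≡1 e = s≤s z≤n
    minimal : ∀ D → D ⊆ ⁅ e ⁆ → rk D < ∣ D ∣ → D ≡ ⁅ e ⁆
    minimal D D⊆e D-dependent with ⊆⁅⁆-cases {D} {e} D⊆e
    ... | inj₁ D≡e  = D≡e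
    ... | inj₂ ∣D∣≡0 = ⊥-elim (<⇒≱ D-dependent (subst (_≤ rk D) (sym ∣D∣≡0) z≤n))

  Loop? : ∀ e → Dec (Loop M e)
  Loop? e with rk ⁅ e ⁆ ≟ 0
  ... | yes rk≡0 = yes (rk≡0⇒Loop rk≡0)
  ... | no  rk≢0 = no (rk≢0 ∘ Loop⇒rk≡0)

  ¬Loop⇒rk≡1 : ∀ {e} → ¬ Loop M e → rk ⁅ e ⁆ ≡ 1
  ¬Loop⇒rk≡1 {e} ¬loop = ≤-antisym (rk⁅⁆≤1 e) (n≢0⇒n>0 (¬loop ∘ rk≡0⇒Loop))

  ⊆nonloop⇒independent : ∀ {D : Subset n} {f} → ¬ Loop M f → D ⊆ ⁅ f ⁆ → ∣ D ∣ ≤ rk D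
  ⊆nonloop⇒independent {D} {f} ¬loop D⊆f with ⊆⁅⁆-cases {D} {f} D⊆f
  ... | inj₁ refl  = ≤-reflexive (trans (Subₚ.∣⁅x⁆∣≡1 f) (sym (¬Loop⇒rk≡1 ¬loop)))
  ... | inj₂ ∣D∣≡0 = subst (_≤ rk D) (sym ∣D∣≡0) z≤n

  rk-∪-shared-nonloop : ∀ {X Y f} → ¬ Loop M f → f ∈ X → f ∈ Y → rk (X ∪ Y) + 1 ≤ rk X + rk Y
  rk-∪-shared-nonloop {X} {Y} {f} ¬loop f∈X f∈Y = begin
    rk (X ∪ Y) + 1          ≡⟨ cong (rk (X ∪ Y) +_) (¬Loop⇒rk≡1 ¬loop) ⟨
    rk (X ∪ Y) + rk ⁅ f ⁆    ≤⟨ +-monoʳ-≤ (rk (X ∪ Y)) (rk-mono f⊆X∩Y) ⟩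
    rk (X ∪ Y) + rk (X ∩ Y)  ≤⟨ rk-submod X Y ⟩
    rk X + rk Y             ∎
    where
    open ≤-Reasoning
    f⊆X∩Y : ⁅ f ⁆ ⊆ X ∩ Y
    f⊆X∩Y x∈f rewrite Subₚ.x∈⁅y⁆⇒x≡y f x∈f = Subₚ.x∈p∩q⁺ (f∈X , f∈Y)

  -- On nonloops, e ∼ f says that e and f are equal or parallel.
  infix 4 _∼_
  _∼_ : Fin n → Fin n → Set
  e ∼ f = rk (⁅ e ⁆ ∪ ⁅ f ⁆) ≤ 1

  ∼-refl : ∀ e → e ∼ e
  ∼-refl e rewrite Subₚ.∪-idem ⁅ e ⁆ = rk⁅⁆≤1 e

  ∼-sym : ∀ {e f} → e ∼ f → f ∼ e
  ∼-sym {e} {f} e∼f rewrite Subₚ.∪-comm ⁅ f ⁆ ⁅ e ⁆ = e∼f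

  ∼-trans : ∀ {e f g} → ¬ Loop M f → e ∼ f → f ∼ g → e ∼ g
  ∼-trans {e} {f} {g} ¬loop e∼f f∼g = ≤-trans (rk-mono eg⊆efg) (+-cancelʳ-≤ 1 _ 1
    (≤-trans (rk-∪-shared-nonloop ¬loop (Subₚ.x∈p∪q⁺ (inj₂ (Subₚ.x∈⁅x⁆ f))) (Subₚ.x∈p∪q⁺ (inj₁ (Subₚ.x∈⁅x⁆ f))))
             (+-mono-≤ e∼f f∼g)))
    where
    eg⊆efg : ⁅ e ⁆ ∪ ⁅ g ⁆ ⊆ (⁅ e ⁆ ∪ ⁅ f ⁆) ∪ (⁅ f ⁆ ∪ ⁅ g ⁆)
    eg⊆efg x∈eg with Subₚ.x∈p∪q⁻ ⁅ e ⁆ ⁅ g ⁆ x∈eg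
    ... | inj₁ x∈e = Subₚ.x∈p∪q⁺ (inj₁ (Subₚ.x∈p∪q⁺ (inj₁ x∈e)))
    ... | inj₂ x∈g = Subₚ.x∈p∪q⁺ (inj₂ (Subₚ.x∈p∪q⁺ (inj₂ x∈g)))

  ∣⁅e⁆∪⁅f⁆∣≡2 : ∀ {e f : Fin n} → e ≢ f → ∣ ⁅ e ⁆ ∪ ⁅ f ⁆ ∣ ≡ 2
  ∣⁅e⁆∪⁅f⁆∣≡2 {e} {f} e≢f =
    trans (∣p∪⁅x⁆∣≡1+∣p∣ ⁅ e ⁆ f (e≢f ∘ sym ∘ Subₚ.x∈⁅y⁆⇒x≡y e)) (cong suc (Subₚ.∣⁅x⁆∣≡1 e))

  Parallel⇒∼ : ∀ {e f : Fin n} → Parallel M e f → e ∼ f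
  Parallel⇒∼ {e} {f} (e≢f , dependent , _) = ≤-pred (subst (rk (⁅ e ⁆ ∪ ⁅ f ⁆) <_) (∣⁅e⁆∪⁅f⁆∣≡2 e≢f) dependent)

  Parallel⇒¬Loopʳ : ∀ {e f} → Parallel M e f → ¬ Loop M f
  Parallel⇒¬Loopʳ {e} {f} (e≢f , _ , minimal) (f-dependent , _) =
    e≢f (Subₚ.x∈⁅y⁆⇒x≡y f (subst (e ∈_) (sym f≡ef) (Subₚ.x∈p∪q⁺ (inj₁ (Subₚ.x∈⁅x⁆ e)))))
    where f≡ef = minimal ⁅ f ⁆ (Subₚ.x∈p∪q⁺ ∘ inj₂) f-dependent

  ∼⇒Parallel : ∀ {e f} → e ≢ f → ¬ Loop M e → ¬ Loop M f → e ∼ f → Parallel M e f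
  ∼⇒Parallel {e} {f} e≢f ¬loop-e ¬loop-f e∼f = e≢f , dependent , minimal
    where
    dependent : rk (⁅ e ⁆ ∪ ⁅ f ⁆) < ∣ ⁅ e ⁆ ∪ ⁅ f ⁆ ∣
    dependent = subst (rk (⁅ e ⁆ ∪ ⁅ f ⁆) <_) (sym (∣⁅e⁆∪⁅f⁆∣≡2 e≢f)) (s≤s e∼f)
    minimal : ∀ D → D ⊆ ⁅ e ⁆ ∪ ⁅ f ⁆ → rk D < ∣ D ∣ → D ≡ ⁅ e ⁆ ∪ ⁅ f ⁆
    minimal D D⊆ef D-dependent with e Subₚ.∈? D | f Subₚ.∈? D
    ... | yes e∈D | yes f∈D = Subₚ.⊆-antisym D⊆ef ef⊆D
      where
      ef⊆D : ⁅ e ⁆ ∪ ⁅ f ⁆ ⊆ D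
      ef⊆D x∈ef with Subₚ.x∈p∪q⁻ ⁅ e ⁆ ⁅ f ⁆ x∈ef
      ... | inj₁ x∈e rewrite Subₚ.x∈⁅y⁆⇒x≡y e x∈e = e∈D
      ... | inj₂ x∈f rewrite Subₚ.x∈⁅y⁆⇒x≡y f x∈f = f∈D
    ... | no e∉D | _ = ⊥-elim (<⇒≱ D-dependent (⊆nonloop⇒independent ¬loop-f D⊆f))
      where
      D⊆f : D ⊆ ⁅ f ⁆
      D⊆f {x} x∈D with Subₚ.x∈p∪q⁻ ⁅ e ⁆ ⁅ f ⁆ (D⊆ef x∈D)
      ... | inj₁ x∈e = ⊥-elim (e∉D (subst (_∈ D) (Subₚ.x∈⁅y⁆⇒x≡y e x∈e) x∈D))
      ... | inj₂ x∈f = x∈f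
    ... | yes _ | no f∉D = ⊥-elim (<⇒≱ D-dependent (⊆nonloop⇒independent ¬loop-e D⊆e))
      where
      D⊆e : D ⊆ ⁅ e ⁆
      D⊆e {x} x∈D with Subₚ.x∈p∪q⁻ ⁅ e ⁆ ⁅ f ⁆ (D⊆ef x∈D)
      ... | inj₁ x∈e = x∈e
      ... | inj₂ x∈f = ⊥-elim (f∉D (subst (_∈ D) (Subₚ.x∈⁅y⁆⇒x≡y f x∈f) x∈D))

  -- A sufficient condition for e to lie in the closure of X.
  Spanned : Subset n → Fin n → Set
  Spanned X e = e ∈ X ⊎ Loop M e ⊎ ∃ λ f → f ∈ X × ¬ Loop M f × e ∼ f

  Spanned-mono : ∀ {X X′ e} → X ⊆ X′ → Spanned X e → Spanned X′ e
  Spanned-mono X⊆X′ (inj₁ e∈X)                        = inj₁ (X⊆X′ e∈X)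
  Spanned-mono X⊆X′ (inj₂ (inj₁ loop))                = inj₂ (inj₁ loop)
  Spanned-mono X⊆X′ (inj₂ (inj₂ (f , f∈X , ¬loop , e∼f))) = inj₂ (inj₂ (f , X⊆X′ f∈X , ¬loop , e∼f))

  rk-∪⁅⁆-Spanned : ∀ Z e → Spanned Z e → rk (Z ∪ ⁅ e ⁆) ≤ rk Z
  rk-∪⁅⁆-Spanned Z e (inj₁ e∈Z) = rk-mono Ze⊆Z
    where
    Ze⊆Z : Z ∪ ⁅ e ⁆ ⊆ Z
    Ze⊆Z x∈Ze with Subₚ.x∈p∪q⁻ Z ⁅ e ⁆ x∈Ze
    ... | inj₁ x∈Z = x∈Z
    ... | inj₂ x∈e rewrite Subₚ.x∈⁅y⁆⇒x≡y e x∈e = e∈Z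
  rk-∪⁅⁆-Spanned Z e (inj₂ (inj₁ loop)) = begin
    rk (Z ∪ ⁅ e ⁆)                    ≤⟨ m≤m+n _ _ ⟩
    rk (Z ∪ ⁅ e ⁆) + rk (Z ∩ ⁅ e ⁆)    ≤⟨ rk-submod Z ⁅ e ⁆ ⟩
    rk Z + rk ⁅ e ⁆                   ≡⟨ trans (cong (rk Z +_) (Loop⇒rk≡0 loop)) (+-identityʳ _) ⟩
    rk Z                              ∎
    where open ≤-Reasoning
  rk-∪⁅⁆-Spanned Z e (inj₂ (inj₂ (f , f∈Z , ¬loop , e∼f))) = ≤-trans (rk-mono Ze⊆Zef) (+-cancelʳ-≤ 1 _ _
    (≤-trans (rk-∪-shared-nonloop ¬loop f∈Z (Subₚ.x∈p∪q⁺ (inj₂ (Subₚ.x∈⁅x⁆ f)))) (+-monoʳ-≤ (rk Z) e∼f)))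
    where
    Ze⊆Zef : Z ∪ ⁅ e ⁆ ⊆ Z ∪ (⁅ e ⁆ ∪ ⁅ f ⁆)
    Ze⊆Zef x∈Ze with Subₚ.x∈p∪q⁻ Z ⁅ e ⁆ x∈Ze
    ... | inj₁ x∈Z = Subₚ.x∈p∪q⁺ (inj₁ x∈Z)
    ... | inj₂ x∈e = Subₚ.x∈p∪q⁺ (inj₂ (Subₚ.x∈p∪q⁺ (inj₁ x∈e)))

  private
    _∪ˡ_ : Subset n → List (Fin n) → Subset n
    X ∪ˡ []      = X
    X ∪ˡ (x ∷ L) = (X ∪ˡ L) ∪ ⁅ x ⁆

    ⊆-∪ˡ : ∀ X L → X ⊆ X ∪ˡ L
    ⊆-∪ˡ X []      x∈X = x∈X
    ⊆-∪ˡ X (y ∷ L) x∈X = Subₚ.x∈p∪q⁺ (inj₁ (⊆-∪ˡ X L x∈X))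

    ∈ˡ⇒∈-∪ˡ : ∀ X L {y} → y ∈ˡ L → y ∈ X ∪ˡ L
    ∈ˡ⇒∈-∪ˡ X (x ∷ L) (here refl) = Subₚ.x∈p∪q⁺ (inj₂ (Subₚ.x∈⁅x⁆ x))
    ∈ˡ⇒∈-∪ˡ X (x ∷ L) (there y∈L) = Subₚ.x∈p∪q⁺ (inj₁ (∈ˡ⇒∈-∪ˡ X L y∈L))

    rk-∪ˡ-Spanned : ∀ X L → (∀ x → x ∈ˡ L → Spanned X x) → rk (X ∪ˡ L) ≤ rk X
    rk-∪ˡ-Spanned X []      _       = ≤-refl
    rk-∪ˡ-Spanned X (x ∷ L) spanned =
      ≤-trans (rk-∪⁅⁆-Spanned (X ∪ˡ L) x (Spanned-mono (⊆-∪ˡ X L) (spanned x (here refl))))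
              (rk-∪ˡ-Spanned X L (λ y → spanned y ∘ there))

  rk-Spanned : ∀ X Y → (∀ e → e ∈ Y → Spanned X e) → rk Y ≤ rk X
  rk-Spanned X Y spanned =
    ≤-trans (rk-mono Y⊆) (rk-∪ˡ-Spanned X L (λ x → spanned x ∘ proj₂ ∘ Listₚ.∈-filter⁻ (_∈? Y) {xs = allFin n}))
    where
    _∈?_ = Subₚ._∈?_
    L = filter (_∈? Y) (allFin n)
    Y⊆ : Y ⊆ X ∪ˡ L
    Y⊆ {y} y∈Y = ∈ˡ⇒∈-∪ˡ X L (Listₚ.∈-filter⁺ (_∈? Y) (Listₚ.∈-allFin y) y∈Y)

  DualDependent⇒rk∁<rank : ∀ {C} → DualDependent M C → rk (∁ C) < rank M
  DualDependent⇒rk∁<rank {C} C-dependent with rk (∁ C) <? rk ⊤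
  ... | yes rk∁<rank = rk∁<rank
  ... | no  rk∁≮rank = ⊥-elim (<⇒≱ C-dependent (begin
    ∣ C ∣                       ≤⟨ m≤m+n ∣ C ∣ _ ⟩
    ∣ C ∣ + (rk (∁ C) ∸ rk ⊤)   ≡⟨ +-∸-assoc ∣ C ∣ (≮⇒≥ rk∁≮rank) ⟨
    ∣ C ∣ + rk (∁ C) ∸ rk ⊤     ∎))
    where open ≤-Reasoning

  rk∁<rank⇒DualDependent : ∀ {C} → rk (∁ C) < rank M → 1 ≤ ∣ C ∣ → DualDependent M C
  rk∁<rank⇒DualDependent {C} = c+x∸y<c ∣ C ∣ (rk (∁ C)) (rk ⊤)
    where
    c+x∸y<c : ∀ c x y → x < y → 1 ≤ c → c + x ∸ y < c
    c+x∸y<c (suc c) zero    (suc y) _         _   = s≤s (≤-trans (m∸n≤m (c + 0) y) (≤-reflexive (+-identityʳ c)))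
    c+x∸y<c c       (suc x) (suc y) (s≤s x<y) 1≤c rewrite +-suc c x = c+x∸y<c c x y x<y 1≤c

  DualDependent⇒⊇Cocircuit : ∀ C → DualDependent M C → ∃ λ D → D ⊆ C × Cocircuit M D
  DualDependent⇒⊇Cocircuit C = go ∣ C ∣ C ≤-refl
    where
    go : ∀ k C → ∣ C ∣ ≤ k → DualDependent M C → ∃ λ D → D ⊆ C × Cocircuit M D
    go zero C ∣C∣≤0 C-dependent = ⊥-elim (n≮0 (subst (dualRk M C <_) (n≤0⇒n≡0 ∣C∣≤0) C-dependent))
    go (suc k) C ∣C∣≤1+k C-dependent with Subₚ.anySubset? (λ D → (D Subₚ.⊆? C) ×-dec (dualRk M D <? ∣ D ∣) ×-dec ¬? (D ≟ˢ C))
    ... | no  no-smaller = C , (λ x∈C → x∈C) , C-dependent , minimal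
      where
      minimal : ∀ D → D ⊆ C → DualDependent M D → D ≡ C
      minimal D D⊆C D-dependent = decidable-stable (D ≟ˢ C) (λ D≢C → no-smaller (D , D⊆C , D-dependent , D≢C))
    ... | yes (D , D⊆C , D-dependent , D≢C) with go k D ∣D∣≤k D-dependent
      where
      ∣D∣≤k : ∣ D ∣ ≤ k
      ∣D∣≤k = ≤-pred (≤-trans (Subₚ.p⊂q⇒∣p∣<∣q∣ (D⊆C , C⊈D)) ∣C∣≤1+k)
        where
        C⊈D : ∃ λ x → x ∈ C × x ∉ D
        C⊈D with Finₚ.any? (λ x → (x Subₚ.∈? C) ×-dec ¬? (x Subₚ.∈? D))
        ... | yes witness = witness
        ... | no  none    = ⊥-elim (D≢C (Subₚ.⊆-antisym D⊆C (λ {x} x∈C →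
                              decidable-stable (x Subₚ.∈? D) (λ x∉D → none (x , x∈C , x∉D)))))
    ...   | D′ , D′⊆D , cocircuit = D′ , D⊆C ∘ D′⊆D , cocircuit

∈-tabulate⁺ : ∀ {k} (b : Fin k → Bool) x → b x ≡ true → x ∈ tabulate b
∈-tabulate⁺ b x bx≡true = Vecₚ.lookup⇒[]= x (tabulate b) (≡.trans (Vecₚ.lookup∘tabulate b x) bx≡true)

∈-tabulate⁻ : ∀ {k} (b : Fin k → Bool) x → x ∈ tabulate b → b x ≡ true
∈-tabulate⁻ b x x∈ = ≡.trans (≡.sym (Vecₚ.lookup∘tabulate b x)) (Vecₚ.[]=⇒lookup x∈)

∣tabulate∣ : ∀ k (b : Fin k → Bool) → ∣ tabulate b ∣ ≡ ∑[ x < k ] 𝟙 (b x)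
∣tabulate∣ zero    b = ≡.refl
∣tabulate∣ (suc k) b with b zero
... | true  = ≡.cong suc (∣tabulate∣ k (b ∘ suc))
... | false = ∣tabulate∣ k (b ∘ suc)

module PGMatroid (F : Field) {q : ℕ} (order : FieldOps.HasOrder F q) (r′ : ℕ)
  {n : ℕ} (M : Matroid n) (S : Subset n) (simple : SimplificationSet M S)
  (m : ℕ) (φ : Fin m → Fin n) (p : Fin m → Fin (suc r′) → FieldOps.Carrier F)
  (points : FieldOps.ProjPoints F p)
  (φ-injective : ∀ i i′ → φ i ≡ φ i′ → i ≡ i′)
  (φ-onto-S : ∀ e → (e ∈ S → ∃[ i ] (φ i ≡ e)) × (∃[ i ] (φ i ≡ e) → e ∈ S))
  (φ-rank : ∀ X → X ⊆ S → FieldOps.VRank F p (tabulate (λ i → lookup X (φ i))) (Matroid.rk M X))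
  where

  r = suc r′
  open Matroid M
  open MatroidProperties M
  open FiniteField F order
  open ProjectiveCounting p points
  open LinearAlgebra F order p
  open FieldOps F using (VRank)

  φ∈S : ∀ i → φ i ∈ S
  φ∈S i = proj₂ (φ-onto-S (φ i)) (i , ≡.refl)

  φ-¬Loop : ∀ i → ¬ Loop M (φ i)
  φ-¬Loop i = proj₁ simple (φ i) (φ∈S i)

  φ-∼-injective : ∀ {i j} → φ i ∼ φ j → i ≡ j
  φ-∼-injective {i} {j} φi∼φj with i Finₚ.≟ j
  ... | yes i≡j = i≡j
  ... | no  i≢j = ⊥-elim (proj₁ (proj₂ simple) (φ i) (φ j) (φ∈S i) (φ∈S j)
                            (∼⇒Parallel (i≢j ∘ φ-injective i j) (φ-¬Loop i) (φ-¬Loop j) φi∼φj))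

  representative : ∀ e → ¬ Loop M e → ∃ λ i → e ∼ φ i
  representative e ¬loop with proj₂ (proj₂ simple) e ¬loop
  ... | f , f∈S , f≡e⊎e∥f with proj₁ (φ-onto-S f) f∈S
  ...   | i , ≡.refl = i , e∼f f≡e⊎e∥f
    where
    e∼f : ∀ {f} → f ≡ e ⊎ Parallel M e f → e ∼ f
    e∼f (inj₁ ≡.refl) = ∼-refl e
    e∼f (inj₂ e∥f)    = Parallel⇒∼ e∥f

  point : Fin n → Maybe (Fin m)
  point e with Loop? e
  ... | yes _     = nothing
  ... | no ¬loop = just (proj₁ (representative e ¬loop))

  point≡nothing⇒Loop : ∀ {e} → point e ≡ nothing → Loop M e
  point≡nothing⇒Loop {e} with Loop? e
  ... | yes loop = λ _ → loop
  ... | no  _    = λ ()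

  Loop⇒point≡nothing : ∀ {e} → Loop M e → point e ≡ nothing
  Loop⇒point≡nothing {e} loop with Loop? e
  ... | yes _    = ≡.refl
  ... | no ¬loop = ⊥-elim (¬loop loop)

  point≡just⇒ : ∀ {e i} → point e ≡ just i → ¬ Loop M e × e ∼ φ i
  point≡just⇒ {e} with Loop? e
  ... | yes _    = λ ()
  ... | no ¬loop = λ { ≡.refl → ¬loop , proj₂ (representative e ¬loop) }

  ¬Loop⇒point≡just : ∀ {e} → ¬ Loop M e → ∃ λ i → point e ≡ just i
  ¬Loop⇒point≡just {e} ¬loop with Loop? e
  ... | yes loop  = ⊥-elim (¬loop loop)
  ... | no ¬loop′ = proj₁ (representative e ¬loop′) , ≡.refl

  point-φ : ∀ i → point (φ i) ≡ just i
  point-φ i with ¬Loop⇒point≡just (φ-¬Loop i)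
  ... | j , point≡j = ≡.trans point≡j (≡.cong just (≡.sym (φ-∼-injective (proj₂ (point≡just⇒ point≡j)))))

  point-∼ : ∀ {e f i j} → point e ≡ just i → point f ≡ just j → e ∼ f → i ≡ j
  point-∼ pe≡i pf≡j e∼f with point≡just⇒ pe≡i | point≡just⇒ pf≡j
  ... | ¬loop-e , e∼φi | ¬loop-f , f∼φj = φ-∼-injective (∼-trans ¬loop-f (∼-trans ¬loop-e (∼-sym e∼φi) e∼f) f∼φj)

  same-point⇒∼ : ∀ {e f i} → point e ≡ just i → point f ≡ just i → e ∼ f
  same-point⇒∼ {i = i} pe≡i pf≡i = ∼-trans (φ-¬Loop i) (proj₂ (point≡just⇒ pe≡i)) (∼-sym (proj₂ (point≡just⇒ pf≡i)))

  in-image? : ∀ T e → Dec (∃ λ i → i ∈ T × φ i ≡ e)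
  in-image? T e = Finₚ.any? (λ i → (i Subₚ.∈? T) ×-dec (φ i Finₚ.≟ e))

  image : Subset m → Subset n
  image T = tabulate (does ∘ in-image? T)

  image-∈⁺ : ∀ {T i} → i ∈ T → φ i ∈ image T
  image-∈⁺ {T} {i} i∈T = ∈-tabulate⁺ (does ∘ in-image? T) (φ i) (dec-true (in-image? T (φ i)) (i , i∈T , ≡.refl))

  image-∈⁻ : ∀ {T e} → e ∈ image T → ∃ λ i → i ∈ T × φ i ≡ e
  image-∈⁻ {T} {e} e∈ = does-true⇒ (in-image? T e) (∈-tabulate⁻ (does ∘ in-image? T) e e∈)

  image⊆S : ∀ T → image T ⊆ S
  image⊆S T e∈ with image-∈⁻ e∈
  ... | i , _ , ≡.refl = φ∈S i

  preimage-image : ∀ T → tabulate (λ i → lookup (image T) (φ i)) ≡ T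
  preimage-image T = Subₚ.⊆-antisym ⊆T T⊆
    where
    ⊆T : tabulate (λ i → lookup (image T) (φ i)) ⊆ T
    ⊆T {i} i∈ with image-∈⁻ {T} (Vecₚ.lookup⇒[]= (φ i) (image T) (∈-tabulate⁻ _ i i∈))
    ... | i′ , i′∈T , φi′≡φi = ≡.subst (_∈ T) (φ-injective i′ i φi′≡φi) i′∈T
    T⊆ : T ⊆ tabulate (λ i → lookup (image T) (φ i))
    T⊆ {i} i∈T = ∈-tabulate⁺ _ i (Vecₚ.[]=⇒lookup (image-∈⁺ i∈T))

  VRank-image : ∀ T → VRank p T (rk (image T))
  VRank-image T = ≡.subst (λ Z → VRank p Z (rk (image T))) (preimage-image T) (φ-rank (image T) (image⊆S T))

  rk-image⊤≤r : rk (image ⊤) ℕ.≤ r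
  rk-image⊤≤r with VRank-image ⊤
  ... | (Y , _ , Y-indep , ∣Y∣≡rk) , _ = ≡.subst (ℕ._≤ r) ∣Y∣≡rk (LinIndep⇒∣∣≤r Y-indep)

  rank≤rk-image⊤ : rank M ℕ.≤ rk (image ⊤)
  rank≤rk-image⊤ = rk-Spanned (image ⊤) ⊤ spanned
    where
    spanned : ∀ e → e ∈ ⊤ → Spanned (image ⊤) e
    spanned e _ with point e in pe
    ... | nothing = inj₂ (inj₁ (point≡nothing⇒Loop pe))
    ... | just i  = inj₂ (inj₂ (φ i , image-∈⁺ Subₚ.∈⊤ , φ-¬Loop i , proj₂ (point≡just⇒ pe)))

  offᵇ : Vec (Fin q) r → Fin m → Bool
  offᵇ a i = not (dot a (p i) ≈ᵇ 0#)

  off-point : Vec (Fin q) r → Maybe (Fin m) → Bool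
  off-point a nothing  = false
  off-point a (just i) = offᵇ a i

  C : Vec (Fin q) r → Subset n
  C a = tabulate (off-point a ∘ point)

  offᵇ≡true⇒ : ∀ {a i} → offᵇ a i ≡ true → ¬ dot a (p i) ≈ 0#
  offᵇ≡true⇒ {a} {i} with dot a (p i) ≈? 0#
  ... | yes _     = λ ()
  ... | no a·pi≉0 = λ _ → a·pi≉0

  offᵇ≡false⇒ : ∀ {a i} → offᵇ a i ≡ false → dot a (p i) ≈ 0#
  offᵇ≡false⇒ {a} {i} with dot a (p i) ≈? 0#
  ... | yes a·pi≈0 = λ _ → a·pi≈0
  ... | no  _      = λ ()

  φ∈C : ∀ a i → ¬ dot a (p i) ≈ 0# → φ i ∈ C a
  φ∈C a i a·pi≉0 = ∈-tabulate⁺ _ (φ i) (≡.trans (≡.cong (off-point a) (point-φ i)) (≡.cong not (≉⇒≈ᵇ a·pi≉0)))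

  basis : Fin r → Fin r → Carrier
  basis j k with k Finₚ.≟ j
  ... | yes _ = 1#
  ... | no  _ = 0#

  basis-≡ : ∀ j → basis j j ≈ 1#
  basis-≡ j with j Finₚ.≟ j
  ... | yes _   = refl
  ... | no  j≢j = ⊥-elim (j≢j ≡.refl)

  basis-≢ : ∀ j k → k ≢ j → basis j k ≈ 0#
  basis-≢ j k k≢j with k Finₚ.≟ j
  ... | yes k≡j = ⊥-elim (k≢j k≡j)
  ... | no  _   = refl

  -- The points span F^r, so a nonzero functional misses some point.
  Nonzero⇒off-point : ∀ a → Nonzero (ev a) → ∃ λ i → ¬ dot a (p i) ≈ 0#
  Nonzero⇒off-point a (j , aj≉0) with proj₁ (proj₂ points) (basis j) (λ basis≈0 → Field.1≉0 F (trans (sym (basis-≡ j)) (basis≈0 j)))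
  ... | i , l , basis≈lp = i , λ a·pi≈0 → aj≉0 (begin
    ev a j                        ≈⟨ *-identityʳ _ ⟨
    ev a j * 1#                   ≈⟨ *-congˡ (basis-≡ j) ⟨
    ev a j * basis j j            ≈⟨ sumF-single j (λ k k≢j → trans (*-congˡ (basis-≢ j k k≢j)) (zeroʳ (ev a k))) ⟨
    dot a (basis j)               ≈⟨ ·-cong {b = ev a} (λ _ → refl) basis≈lp ⟩
    dot a (λ k → l * p i k)       ≈⟨ ·-*ʳ (ev a) (p i) l ⟩
    l * dot a (p i)               ≈⟨ *-congˡ a·pi≈0 ⟩
    l * 0#                        ≈⟨ zeroʳ l ⟩
    0#                            ∎)
    where open ≈-Reasoning

  C-DualDependent : ∀ a → Nonzero (ev a) → DualDependent M (C a)
  C-DualDependent a a≢0 with Nonzero⇒off-point a a≢0 | VRank-image (tabulate (λ i → dot a (p i) ≈ᵇ 0#))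
  ... | z , a·pz≉0 | (Y , Y⊆H , Y-indep , ∣Y∣≡rk) , _ = rk∁<rank⇒DualDependent {C a} rk∁C<rank 1≤∣C∣
    where
    H = tabulate (λ i → dot a (p i) ≈ᵇ 0#)
    a⊥H : ∀ {i} → i ∈ H → dot a (p i) ≈ 0#
    a⊥H {i} i∈H = ≈ᵇ⇒≈ (∈-tabulate⁻ _ i i∈H)
    rk∁C≤ : rk (∁ (C a)) ℕ.≤ rk (image H)
    rk∁C≤ = rk-Spanned (image H) (∁ (C a)) spanned
      where
      spanned : ∀ e → e ∈ ∁ (C a) → Spanned (image H) e
      spanned e e∉C with point e in pe
      ... | nothing = inj₂ (inj₁ (point≡nothing⇒Loop pe))
      ... | just i  = inj₂ (inj₂ (φ i , image-∈⁺ (∈-tabulate⁺ _ i (≈⇒≈ᵇ (offᵇ≡false⇒ {a} {i} on))) , φ-¬Loop i ,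
                                  proj₂ (point≡just⇒ pe)))
        where
        on : offᵇ a i ≡ false
        on with offᵇ a i in off
        ... | false = ≡.refl
        ... | true  = ⊥-elim (Subₚ.x∈∁p⇒x∉p e∉C (∈-tabulate⁺ _ e (≡.trans (≡.cong (off-point a) pe) off)))
    1+rk≤rank : suc (rk (image H)) ℕ.≤ rank M
    1+rk≤rank = begin
      suc (rk (image H))   ≡⟨ ≡.cong suc ∣Y∣≡rk ⟨
      suc ∣ Y ∣            ≡⟨ ∣p∪⁅x⁆∣≡1+∣p∣ Y z (a·pz≉0 ∘ a⊥H ∘ Y⊆H) ⟨
      ∣ Y ∪ ⁅ z ⁆ ∣        ≤⟨ proj₂ (VRank-image ⊤) (Y ∪ ⁅ z ⁆) (λ _ → Subₚ.∈⊤)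
                                 (LinIndep-extend Y-indep (ev a) (λ y → a⊥H ∘ Y⊆H) z a·pz≉0) ⟩
      rk (image ⊤)         ≤⟨ rk-mono (λ _ → Subₚ.∈⊤) ⟩
      rank M               ∎
      where open ℕₚ.≤-Reasoning
    rk∁C<rank : rk (∁ (C a)) ℕ.< rank M
    rk∁C<rank = ℕₚ.<-≤-trans (s≤s rk∁C≤) 1+rk≤rank
    1≤∣C∣ : 1 ℕ.≤ ∣ C a ∣
    1≤∣C∣ = ≡.subst (ℕ._≤ ∣ C a ∣) (Subₚ.∣⁅x⁆∣≡1 (φ z))
              (Subₚ.p⊆q⇒∣p∣≤∣q∣ (λ x∈φz → ≡.subst (_∈ C a) (≡.sym (Subₚ.x∈⁅y⁆⇒x≡y (φ z) x∈φz)) (φ∈C a z a·pz≉0)))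

  carries? : ∀ D i → Dec (∃ λ e → e ∈ D × point e ≡ just i)
  carries? D i = Finₚ.any? (λ e → (e Subₚ.∈? D) ×-dec Maybeₚ.≡-dec Finₚ._≟_ (point e) (just i))

  points-of : Subset n → Subset m
  points-of D = tabulate (does ∘ carries? D)

  points-of-∈⁺ : ∀ {D e i} → e ∈ D → point e ≡ just i → i ∈ points-of D
  points-of-∈⁺ {D} {e} {i} e∈D pe≡i = ∈-tabulate⁺ (does ∘ carries? D) i (dec-true (carries? D i) (e , e∈D , pe≡i))

  points-of-∈⁻ : ∀ {D i} → i ∈ points-of D → ∃ λ e → e ∈ D × point e ≡ just i
  points-of-∈⁻ {D} {i} i∈ = does-true⇒ (carries? D i) (∈-tabulate⁻ (does ∘ carries? D) i i∈)

  DualDependent⇒⊇C : ∀ D → DualDependent M D → ∃ λ b → Nonzero (ev b) × C b ⊆ D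
  DualDependent⇒⊇C D D-dependent = hyperplane⇒⊇C (orthogonal-functional (VRank-image (points-of (∁ D))) ρ<r)
    where
    spanned : ∀ e → e ∈ image (points-of (∁ D)) → Spanned (∁ D) e
    spanned e e∈ with image-∈⁻ {points-of (∁ D)} e∈
    ... | i , i∈ , ≡.refl with points-of-∈⁻ i∈
    ...   | e′ , e′∉D , pe′≡i = inj₂ (inj₂ (e′ , e′∉D , proj₁ (point≡just⇒ pe′≡i) , ∼-sym (proj₂ (point≡just⇒ pe′≡i))))
    ρ<r : rk (image (points-of (∁ D))) ℕ.< r
    ρ<r = ℕₚ.≤-<-trans (rk-Spanned (∁ D) (image (points-of (∁ D))) spanned)
                       (ℕₚ.<-≤-trans (DualDependent⇒rk∁<rank D-dependent) (ℕₚ.≤-trans rank≤rk-image⊤ rk-image⊤≤r))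
    hyperplane⇒⊇C : (∃ λ b → Nonzero (ev b) × (∀ i → i ∈ points-of (∁ D) → dot b (p i) ≈ 0#)) →
                    ∃ λ b → Nonzero (ev b) × C b ⊆ D
    hyperplane⇒⊇C (b , b≢0 , b⊥) = b , b≢0 , C⊆D
      where
      C⊆D : C b ⊆ D
      C⊆D {e} e∈C with point e in pe | ∈-tabulate⁻ (off-point b ∘ point) e e∈C
      ... | just i | off with e Subₚ.∈? D
      ...   | yes e∈D = e∈D
      ...   | no  e∉D = ⊥-elim (offᵇ≡true⇒ {b} {i} off (b⊥ i (points-of-∈⁺ (Subₚ.x∉p⇒x∈∁p e∉D) pe)))

  #functionals-off-point : ℕ
  #functionals-off-point = q ^ r′ ℕ.* (q ∸ 1)

  #nonzero-scalars≡q∸1 : #nonzero-scalars ≡ q ∸ 1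
  #nonzero-scalars≡q∸1 = ≡.trans (≡.sym (ℕₚ.m+n∸n≡m #nonzero-scalars 1)) (≡.cong (_∸ 1) #nonzero-scalars+1≡q)

  #functionals-off-point+q^r′ : #functionals-off-point ℕ.+ q ^ r′ ≡ q ^ r
  #functionals-off-point+q^r′ = begin
    q ^ r′ ℕ.* (q ∸ 1) ℕ.+ q ^ r′           ≡⟨ ≡.cong (λ x → q ^ r′ ℕ.* x ℕ.+ q ^ r′) #nonzero-scalars≡q∸1 ⟨
    q ^ r′ ℕ.* #nonzero-scalars ℕ.+ q ^ r′   ≡⟨ ≡.cong (q ^ r′ ℕ.* #nonzero-scalars ℕ.+_) (ℕₚ.*-identityʳ (q ^ r′)) ⟨
    q ^ r′ ℕ.* #nonzero-scalars ℕ.+ q ^ r′ ℕ.* 1 ≡⟨ ℕₚ.*-distribˡ-+ (q ^ r′) #nonzero-scalars 1 ⟨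
    q ^ r′ ℕ.* (#nonzero-scalars ℕ.+ 1)    ≡⟨ ≡.cong (q ^ r′ ℕ.*_) #nonzero-scalars+1≡q ⟩
    q ^ r′ ℕ.* q                           ≡⟨ ℕₚ.*-comm (q ^ r′) q ⟩
    q ^ r                                  ∎
    where open ≡.≡-Reasoning

  1≤#functionals-off-point : 1 ℕ.≤ #functionals-off-point
  1≤#functionals-off-point = ℕₚ.*-mono-≤ {1} {q ^ r′} {1} {q ∸ 1}
    (ℕₚ.m^n>0 q {{ℕ.>-nonZero (ℕₚ.<-trans (s≤s z≤n) 1<q)}} r′) (ℕₚ.∸-monoˡ-≤ 1 1<q)

  count-off-point : ∀ i → ∑V r (λ a → 𝟙 (offᵇ a i)) ≡ #functionals-off-point
  count-off-point i = ℕₚ.+-cancelʳ-≡ (q ^ r′) _ _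
    (≡.trans (count-off-hyperplane r′ (p i) (p≢0 i)) (≡.sym #functionals-off-point+q^r′))

  #nonzero-functionals : ℕ
  #nonzero-functionals = ∑V r (λ a → 𝟙 (not (isZeroᵇ a)))

  #nonzero-functionals≡ : #nonzero-functionals ≡ q ^ r ∸ 1
  #nonzero-functionals≡ = ≡.trans (≡.sym (ℕₚ.m+n∸n≡m #nonzero-functionals 1)) (≡.cong (_∸ 1) (count-nonzero-vectors r))

  #nonloops : ℕ
  #nonloops = ∑[ e < n ] 𝟙 (is-just (point e))

  #nonloops≤n : #nonloops ℕ.≤ n
  #nonloops≤n = ∑-𝟙≤ n (is-just ∘ point)

  ∑∣C∣ : ∑V r (λ a → ∣ C a ∣) ≡ #nonloops ℕ.* #functionals-off-point
  ∑∣C∣ = begin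
    ∑V r (λ a → ∣ C a ∣)                                   ≡⟨ ∑V-cong r (λ a → ∣tabulate∣ n (off-point a ∘ point)) ⟩
    ∑V r (λ a → ∑[ e < n ] 𝟙 (off-point a (point e)))      ≡⟨ ∑V-comm r n (λ a e → 𝟙 (off-point a (point e))) ⟩
    ∑[ e < n ] ∑V r (λ a → 𝟙 (off-point a (point e)))      ≡⟨ ∑-cong n (λ e → per-element (point e)) ⟩
    ∑[ e < n ] (𝟙 (is-just (point e)) ℕ.* #functionals-off-point) ≡⟨ ∑-*ʳ n #functionals-off-point _ ⟩
    #nonloops ℕ.* #functionals-off-point                   ∎
    where
    open ≡.≡-Reasoning
    per-element : ∀ t → ∑V r (λ a → 𝟙 (off-point a t)) ≡ 𝟙 (is-just t) ℕ.* #functionals-off-point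
    per-element nothing  = ∑V-zero r (λ _ → ≡.refl)
    per-element (just i) = ≡.trans (count-off-point i) (≡.sym (ℕₚ.+-identityʳ _))

  Nonzero-ev : ∀ (a : Vec (Fin q) r) → isZeroᵇ a ≡ false → Nonzero (ev a)
  Nonzero-ev a a≢0 with nonzero? (ev a)
  ... | yes a≢0′ = a≢0′
  ... | no  a≡0  = ⊥-elim (does-false⇒ (isZero? (ev a)) a≢0 (¬Nonzero⇒≈0 a≡0))

  module _ (g : ℕ) (cogirth : IsCogirth M g) where

    g≤∣C∣ : ∀ a → Nonzero (ev a) → g ℕ.≤ ∣ C a ∣
    g≤∣C∣ a a≢0 with DualDependent⇒⊇Cocircuit (C a) (C-DualDependent a a≢0)
    ... | D , D⊆C , D-cocircuit = ℕₚ.≤-trans (proj₂ cogirth D D-cocircuit) (Subₚ.p⊆q⇒∣p∣≤∣q∣ D⊆C)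

    g*𝟙≤∣C∣ : ∀ a → g ℕ.* 𝟙 (not (isZeroᵇ a)) ℕ.≤ ∣ C a ∣
    g*𝟙≤∣C∣ a with isZeroᵇ a in a≟0
    ... | true  = ℕₚ.≤-trans (ℕₚ.≤-reflexive (ℕₚ.*-zeroʳ g)) z≤n
    ... | false = ℕₚ.≤-trans (ℕₚ.≤-reflexive (ℕₚ.*-identityʳ g)) (g≤∣C∣ a (Nonzero-ev a a≟0))

    g*#nonzero≤∑∣C∣ : g ℕ.* #nonzero-functionals ℕ.≤ #nonloops ℕ.* #functionals-off-point
    g*#nonzero≤∑∣C∣ = ≡.subst₂ ℕ._≤_ (∑V-*ˡ r g (λ a → 𝟙 (not (isZeroᵇ a)))) ∑∣C∣ (∑V-mono-≤ r g*𝟙≤∣C∣)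

    cogirth-bound : g ℕ.* (q ^ r ∸ 1) ℕ.≤ n ℕ.* #functionals-off-point
    cogirth-bound = ≡.subst (λ k → g ℕ.* k ℕ.≤ n ℕ.* #functionals-off-point) #nonzero-functionals≡
                            (ℕₚ.≤-trans g*#nonzero≤∑∣C∣ (ℕₚ.*-monoˡ-≤ #functionals-off-point #nonloops≤n))

  at : Fin m → Maybe (Fin m) → Bool
  at i nothing  = false
  at i (just j) = does (j Finₚ.≟ i)

  elsewhere : Fin m → Maybe (Fin m) → Bool
  elsewhere i nothing  = false
  elsewhere i (just j) = not (does (j Finₚ.≟ i))

  at+elsewhere : ∀ i t → 𝟙 (at i t) ℕ.+ 𝟙 (elsewhere i t) ≡ 𝟙 (is-just t)
  at+elsewhere i nothing  = ≡.refl
  at+elsewhere i (just j) = 𝟙-+-not (does (j Finₚ.≟ i))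

  at-≡ : ∀ {i t} → at i t ≡ true → t ≡ just i
  at-≡ {i} {just j} at≡true = ≡.cong just (does-true⇒ (j Finₚ.≟ i) at≡true)

  at-refl : ∀ i → at i (just i) ≡ true
  at-refl i = dec-true (i Finₚ.≟ i) ≡.refl

  class : Fin m → Subset n
  class i = tabulate (at i ∘ point)

  #class : Fin m → ℕ
  #class i = ∑[ e < n ] 𝟙 (at i (point e))

  #elsewhere : Fin m → ℕ
  #elsewhere i = ∑[ e < n ] 𝟙 (elsewhere i (point e))

  #class+#elsewhere : ∀ i → #class i ℕ.+ #elsewhere i ≡ #nonloops
  #class+#elsewhere i = ≡.trans (≡.sym (∑-distrib-+ {n} _ _)) (∑-cong n (λ e → at+elsewhere i (point e)))

  class-is-parallel-class : ∀ {e i} → point e ≡ just i → ∀ f → f ∈ class i ⇔ (f ≡ e ⊎ Parallel M e f)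
  class-is-parallel-class {e} {i} pe≡i f = mk⇔ to from
    where
    to : f ∈ class i → f ≡ e ⊎ Parallel M e f
    to f∈class with f Finₚ.≟ e
    ... | yes f≡e = inj₁ f≡e
    ... | no  f≢e = inj₂ (∼⇒Parallel (f≢e ∘ ≡.sym) (proj₁ (point≡just⇒ pe≡i)) (proj₁ (point≡just⇒ pf≡i))
                                      (same-point⇒∼ pe≡i pf≡i))
      where pf≡i = at-≡ (∈-tabulate⁻ _ f f∈class)
    from : f ≡ e ⊎ Parallel M e f → f ∈ class i
    from (inj₁ ≡.refl) = ∈-tabulate⁺ _ f (≡.trans (≡.cong (at i) pe≡i) (at-refl i))
    from (inj₂ e∥f) with ¬Loop⇒point≡just (Parallel⇒¬Loopʳ e∥f)
    ... | j , pf≡j rewrite point-∼ pe≡i pf≡j (Parallel⇒∼ e∥f) = ∈-tabulate⁺ _ f (≡.trans (≡.cong (at j) pf≡j) (at-refl j))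

  ParClassSize-#class : ∀ {e i} → point e ≡ just i → ParClassSize M e (#class i)
  ParClassSize-#class {e} {i} pe≡i = class i , ∣tabulate∣ n (at i ∘ point) , λ f →
    Equivalence.to (class-is-parallel-class pe≡i f) , Equivalence.from (class-is-parallel-class pe≡i f)

  ParClassSize⇒#class≡ : ∀ {e i k} → point e ≡ just i → ParClassSize M e k → #class i ≡ k
  ParClassSize⇒#class≡ {e} {i} pe≡i (P , ∣P∣≡k , P-is-class) =
    ≡.trans (≡.sym (∣tabulate∣ n (at i ∘ point))) (≡.trans (≡.cong ∣_∣ class≡P) ∣P∣≡k)
    where
    class≡P : class i ≡ P
    class≡P = Subₚ.⊆-antisym
      (λ {f} f∈class → proj₂ (P-is-class f) (Equivalence.to (class-is-parallel-class pe≡i f) f∈class))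
      (λ {f} f∈P → Equivalence.from (class-is-parallel-class pe≡i f) (proj₁ (P-is-class f) f∈P))

  ∑-off-∣C∣ : ∀ i X → (∀ j → i ≢ j → off-two-points p i j ≡ X) →
    ∑V r (λ a → 𝟙 (offᵇ a i) ℕ.* ∣ C a ∣) ≡ #class i ℕ.* #functionals-off-point ℕ.+ #elsewhere i ℕ.* X
  ∑-off-∣C∣ i X constant = begin
    ∑V r (λ a → 𝟙 (offᵇ a i) ℕ.* ∣ C a ∣)
      ≡⟨ ∑V-cong r (λ a → ≡.trans (≡.cong (𝟙 (offᵇ a i) ℕ.*_) (∣tabulate∣ n (off-point a ∘ point)))
                                  (≡.sym (∑-*ˡ n (𝟙 (offᵇ a i)) (λ e → 𝟙 (off-point a (point e)))))) ⟩
    ∑V r (λ a → ∑[ e < n ] (𝟙 (offᵇ a i) ℕ.* 𝟙 (off-point a (point e))))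
      ≡⟨ ∑V-comm r n (λ a e → 𝟙 (offᵇ a i) ℕ.* 𝟙 (off-point a (point e))) ⟩
    ∑[ e < n ] ∑V r (λ a → 𝟙 (offᵇ a i) ℕ.* 𝟙 (off-point a (point e)))
      ≡⟨ ∑-cong n (λ e → per-element (point e)) ⟩
    ∑[ e < n ] (𝟙 (at i (point e)) ℕ.* B ℕ.+ 𝟙 (elsewhere i (point e)) ℕ.* X)
      ≡⟨ ∑-distrib-+ {n} (λ e → 𝟙 (at i (point e)) ℕ.* B) _ ⟩
    ∑[ e < n ] (𝟙 (at i (point e)) ℕ.* B) ℕ.+ ∑[ e < n ] (𝟙 (elsewhere i (point e)) ℕ.* X)
      ≡⟨ ≡.cong₂ ℕ._+_ (∑-*ʳ n B (λ e → 𝟙 (at i (point e)))) (∑-*ʳ n X (λ e → 𝟙 (elsewhere i (point e)))) ⟩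
    #class i ℕ.* B ℕ.+ #elsewhere i ℕ.* X ∎
    where
    open ≡.≡-Reasoning
    B = #functionals-off-point
    per-element : ∀ t → ∑V r (λ a → 𝟙 (offᵇ a i) ℕ.* 𝟙 (off-point a t)) ≡ 𝟙 (at i t) ℕ.* B ℕ.+ 𝟙 (elsewhere i t) ℕ.* X
    per-element nothing = ∑V-zero r (λ a → ℕₚ.*-zeroʳ (𝟙 (offᵇ a i)))
    per-element (just j) with j Finₚ.≟ i
    ... | yes ≡.refl = ≡.trans (∑V-cong r (λ a → 𝟙-idem (offᵇ a i)))
                               (≡.trans (count-off-point i) (≡.sym (≡.trans (ℕₚ.+-identityʳ _) (ℕₚ.+-identityʳ B))))
    ... | no  j≢i    = ≡.trans (constant j (j≢i ∘ ≡.sym)) (≡.sym (ℕₚ.+-identityʳ X))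

  some-point : Fin m
  some-point = proj₁ (proj₁ (proj₂ points) (basis zero) (λ basis≈0 → Field.1≉0 F (trans (sym (basis-≡ zero)) (basis≈0 zero))))

  offᵇ⇒isZeroᵇ≡false : ∀ a i → offᵇ a i ≡ true → isZeroᵇ a ≡ false
  offᵇ⇒isZeroᵇ≡false a i off =
    dec-false (isZero? (ev a)) (λ a≈0 → offᵇ≡true⇒ {a} {i} off (trans (·-comm (ev a) (p i)) (·-zeroʳ (p i) a≈0)))

  module Forward (g : ℕ) (cogirth : IsCogirth M g)
                 (equality : g ℕ.* (q ^ r ∸ 1) ≡ n ℕ.* #functionals-off-point) where

    B = #functionals-off-point

    g*#nonzero≡n*B : g ℕ.* #nonzero-functionals ≡ n ℕ.* B
    g*#nonzero≡n*B = ≡.trans (≡.cong (g ℕ.*_) #nonzero-functionals≡) equality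

    #nonloops≡n : #nonloops ≡ n
    #nonloops≡n = ℕₚ.≤-antisym #nonloops≤n (ℕₚ.*-cancelʳ-≤ n #nonloops B {{ℕ.>-nonZero 1≤#functionals-off-point}}
      (≡.subst (ℕ._≤ #nonloops ℕ.* B) g*#nonzero≡n*B (g*#nonzero≤∑∣C∣ g cogirth)))

    every-element-has-point : ∀ e → 𝟙 (is-just (point e)) ≡ 1
    every-element-has-point = ∑-≤-tight n (λ e → 𝟙≤1 (is-just (point e)))
      (ℕₚ.≤-reflexive (≡.trans (≡.trans (∑-const n 1) (ℕₚ.*-identityʳ n)) (≡.sym #nonloops≡n)))

    loopless : Loopless M
    loopless e loop =
      ℕₚ.0≢1+n (≡.trans (≡.cong (𝟙 ∘ is-just) (≡.sym (Loop⇒point≡nothing loop))) (every-element-has-point e))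

    ∣C∣≡g : ∀ a → g ℕ.* 𝟙 (not (isZeroᵇ a)) ≡ ∣ C a ∣
    ∣C∣≡g = ∑V-≤-tight r (g*𝟙≤∣C∣ g cogirth) (ℕₚ.≤-reflexive (begin
      ∑V r (λ a → ∣ C a ∣)                          ≡⟨ ∑∣C∣ ⟩
      #nonloops ℕ.* B                               ≡⟨ ≡.cong (ℕ._* B) #nonloops≡n ⟩
      n ℕ.* B                                       ≡⟨ g*#nonzero≡n*B ⟨
      g ℕ.* #nonzero-functionals                    ≡⟨ ∑V-*ˡ r g (λ a → 𝟙 (not (isZeroᵇ a))) ⟨
      ∑V r (λ a → g ℕ.* 𝟙 (not (isZeroᵇ a)))        ∎))
      where open ≡.≡-Reasoning

    ∑-off-∣C∣≡g*B : ∀ i → ∑V r (λ a → 𝟙 (offᵇ a i) ℕ.* ∣ C a ∣) ≡ g ℕ.* B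
    ∑-off-∣C∣≡g*B i = ≡.trans (∑V-cong r ∣C∣≡g-off) (≡.trans (∑V-*ʳ r g (λ a → 𝟙 (offᵇ a i)))
                             (≡.trans (≡.cong (ℕ._* g) (count-off-point i)) (ℕₚ.*-comm B g)))
      where
      ∣C∣≡g-off : ∀ a → 𝟙 (offᵇ a i) ℕ.* ∣ C a ∣ ≡ 𝟙 (offᵇ a i) ℕ.* g
      ∣C∣≡g-off a with offᵇ a i in off
      ... | false = ≡.refl
      ... | true  = ≡.cong (ℕ._+ 0) (≡.trans (≡.sym (∣C∣≡g a))
                      (≡.trans (≡.cong (λ b → g ℕ.* 𝟙 (not b)) (offᵇ⇒isZeroᵇ≡false a i off)) (ℕₚ.*-identityʳ g)))

    #class-constant : ∀ i j → #class i ≡ #class j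
    #class-constant i j with i Finₚ.≟ j
    ... | yes i≡j = ≡.cong #class i≡j
    ... | no  i≢j = split-injective X<B
      (≡.trans (#class+#elsewhere i) (≡.sym (#class+#elsewhere j)))
      (≡.trans (≡.sym (∑-off-∣C∣ i X (λ k i≢k → off-two-points-constant r′ p points i≢k i≢j)))
      (≡.trans (∑-off-∣C∣≡g*B i)
      (≡.trans (≡.sym (∑-off-∣C∣≡g*B j))
               (∑-off-∣C∣ j X (λ k j≢k → off-two-points-constant r′ p points j≢k i≢j)))))
      where
      X = off-two-points p i j
      X<B : X ℕ.< B
      X<B = ℕₚ.+-cancelʳ-< (q ^ r′) X B
              (≡.subst (X ℕ.+ q ^ r′ ℕ.<_) (≡.sym #functionals-off-point+q^r′) (off-two-points< r′ p points i≢j))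

    equal-parallel-classes : ∃ λ k → ∀ e → ParClassSize M e k
    equal-parallel-classes = #class some-point , λ e → class-size e (¬Loop⇒point≡just (loopless e))
      where
      class-size : ∀ e → (∃ λ i → point e ≡ just i) → ParClassSize M e (#class some-point)
      class-size e (i , pe≡i) = ≡.subst (ParClassSize M e) (#class-constant i some-point) (ParClassSize-#class pe≡i)

  ∑-at : ∀ j (h : Fin m → ℕ) → ∑[ i < m ] (𝟙 (at i (just j)) ℕ.* h i) ≡ h j
  ∑-at j h = ≡.trans (∑-single m j (λ i i≢j → ≡.cong (λ b → 𝟙 b ℕ.* h i) (dec-false (j Finₚ.≟ i) (i≢j ∘ ≡.sym))))
                     (≡.trans (≡.cong (λ b → 𝟙 b ℕ.* h j) (at-refl j)) (ℕₚ.+-identityʳ (h j)))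

  module Reverse (g : ℕ) (cogirth : IsCogirth M g) (loopless : Loopless M)
                 (k : ℕ) (classes : ∀ e → ParClassSize M e k) where

    B = #functionals-off-point

    #class≡k : ∀ i → #class i ≡ k
    #class≡k i = ParClassSize⇒#class≡ (point-φ i) (classes (φ i))

    ∑-class : ∀ (h : Fin m → ℕ) → ∑[ e < n ] ∑[ i < m ] (𝟙 (at i (point e)) ℕ.* h i) ≡ k ℕ.* ∑[ i < m ] h i
    ∑-class h = begin
      ∑[ e < n ] ∑[ i < m ] (𝟙 (at i (point e)) ℕ.* h i)  ≡⟨ ∑-comm {n} {m} (λ e i → 𝟙 (at i (point e)) ℕ.* h i) ⟩
      ∑[ i < m ] ∑[ e < n ] (𝟙 (at i (point e)) ℕ.* h i)  ≡⟨ ∑-cong m (λ i → ∑-*ʳ n (h i) (λ e → 𝟙 (at i (point e)))) ⟩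
      ∑[ i < m ] (#class i ℕ.* h i)                       ≡⟨ ∑-cong m (λ i → ≡.cong (ℕ._* h i) (#class≡k i)) ⟩
      ∑[ i < m ] (k ℕ.* h i)                              ≡⟨ ∑-*ˡ m k h ⟩
      k ℕ.* ∑[ i < m ] h i                                ∎
      where open ≡.≡-Reasoning

    ∑-over-point : ∀ e (h : Fin m → ℕ) (h′ : Maybe (Fin m) → ℕ) → (∀ j → h′ (just j) ≡ h j) →
                   h′ (point e) ≡ ∑[ i < m ] (𝟙 (at i (point e)) ℕ.* h i)
    ∑-over-point e h h′ h′≡h with ¬Loop⇒point≡just (loopless e)
    ... | j , pe≡j rewrite pe≡j = ≡.trans (h′≡h j) (≡.sym (∑-at j h))

    n≡m*k : n ≡ m ℕ.* k
    n≡m*k = begin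
      n                                                   ≡⟨ ℕₚ.*-identityʳ n ⟨
      n ℕ.* 1                                             ≡⟨ ∑-const n 1 ⟨
      ∑[ e < n ] 1                                        ≡⟨ ∑-cong n (λ e → ∑-over-point e (λ _ → 1) (λ _ → 1) (λ _ → ≡.refl)) ⟩
      ∑[ e < n ] ∑[ i < m ] (𝟙 (at i (point e)) ℕ.* 1)    ≡⟨ ∑-class (λ _ → 1) ⟩
      k ℕ.* ∑[ i < m ] 1                                  ≡⟨ ≡.cong (k ℕ.*_) (≡.trans (∑-const m 1) (ℕₚ.*-identityʳ m)) ⟩
      k ℕ.* m                                             ≡⟨ ℕₚ.*-comm k m ⟩
      m ℕ.* k                                             ∎
      where open ≡.≡-Reasoning

    #points-off : Vec (Fin q) r → ℕ
    #points-off a = ∑[ i < m ] 𝟙 (offᵇ a i)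

    ∣C∣≡k*#points-off : ∀ a → ∣ C a ∣ ≡ k ℕ.* #points-off a
    ∣C∣≡k*#points-off a = begin
      ∣ C a ∣
        ≡⟨ ∣tabulate∣ n (off-point a ∘ point) ⟩
      ∑[ e < n ] 𝟙 (off-point a (point e))
        ≡⟨ ∑-cong n (λ e → ∑-over-point e (λ i → 𝟙 (offᵇ a i)) (𝟙 ∘ off-point a) (λ _ → ≡.refl)) ⟩
      ∑[ e < n ] ∑[ i < m ] (𝟙 (at i (point e)) ℕ.* 𝟙 (offᵇ a i))
        ≡⟨ ∑-class (λ i → 𝟙 (offᵇ a i)) ⟩
      k ℕ.* #points-off a ∎
      where open ≡.≡-Reasoning

    -- Both sides count the vectors off the hyperplane a ⊥, each point off it accounting for q - 1 of them.
    #nonzero-scalars*#points-off : ∀ a → Nonzero (ev a) → #nonzero-scalars ℕ.* #points-off a ≡ B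
    #nonzero-scalars*#points-off a a≢0 = ≡.trans (≡.sym (∑-projective P P-cong P-scale))
      (≡.trans (∑V-cong r same) (count-off-point-functional))
      where
      P : (Fin r → Carrier) → Bool
      P w = not (ev a · w ≈ᵇ 0#)
      P-cong : ∀ w w′ → (∀ j → w j ≈ w′ j) → P w ≡ P w′
      P-cong w w′ w≈w′ = ≡.cong not (≈ᵇ-cong (·-cong {b = ev a} (λ _ → refl) w≈w′) refl)
      P-scale : ∀ l w → ¬ l ≈ 0# → P (λ j → l * w j) ≡ P w
      P-scale l w l≉0 = ≡.cong not (≈ᵇ-⇔ (mk⇔
        (λ a·lw≈0 → x*a≈0⇒x≈0 l≉0 (trans (*-comm _ l) (trans (sym (·-*ʳ (ev a) w l)) a·lw≈0)))
        (λ a·w≈0 → trans (·-*ʳ (ev a) w l) (trans (*-congˡ a·w≈0) (zeroʳ l)))))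
      same : ∀ v → 𝟙 (not (isZeroᵇ v)) ℕ.* 𝟙 (P (ev v)) ≡ 𝟙 (not (dot v (ev a) ≈ᵇ 0#))
      same v with isZeroᵇ v in v≟0
      ... | true  = ≡.cong (𝟙 ∘ not) (≡.sym (≈⇒≈ᵇ (trans (·-comm (ev v) (ev a))
                                                         (·-zeroʳ (ev a) (does-true⇒ (isZero? (ev v)) v≟0)))))
      ... | false = ≡.trans (ℕₚ.+-identityʳ _) (≡.cong (𝟙 ∘ not) (≈ᵇ-cong (·-comm (ev a) (ev v)) refl))
      count-off-point-functional : ∑V r (λ v → 𝟙 (not (dot v (ev a) ≈ᵇ 0#))) ≡ B
      count-off-point-functional = ℕₚ.+-cancelʳ-≡ (q ^ r′) _ _
        (≡.trans (count-off-hyperplane r′ (ev a) a≢0) (≡.sym #functionals-off-point+q^r′))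

    #nonzero-scalars*m : #nonzero-scalars ℕ.* m ≡ #nonzero-functionals
    #nonzero-scalars*m = begin
      #nonzero-scalars ℕ.* m                           ≡⟨ ≡.cong (#nonzero-scalars ℕ.*_) (≡.trans (∑-const m 1) (ℕₚ.*-identityʳ m)) ⟨
      #nonzero-scalars ℕ.* ∑[ i < m ] 1                ≡⟨ ∑-projective (λ _ → true) (λ _ _ _ → ≡.refl) (λ _ _ _ → ≡.refl) ⟨
      ∑V r (λ v → 𝟙 (not (isZeroᵇ v)) ℕ.* 1)            ≡⟨ ∑V-cong r (λ v → ℕₚ.*-identityʳ (𝟙 (not (isZeroᵇ v)))) ⟩
      #nonzero-functionals                             ∎
      where open ≡.≡-Reasoning

    equality : g ℕ.* (q ^ r ∸ 1) ≡ n ℕ.* B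
    equality = via-C (DualDependent⇒⊇C D (proj₁ D-cocircuit))
      where
      D = proj₁ (proj₁ cogirth)
      D-cocircuit = proj₁ (proj₂ (proj₁ cogirth))
      ∣D∣≡g = proj₂ (proj₂ (proj₁ cogirth))
      rearrange : ∀ a b c d → a ℕ.* b ℕ.* (c ℕ.* d) ≡ d ℕ.* a ℕ.* (c ℕ.* b)
      rearrange = solve-∀
      via-C : (∃ λ b → Nonzero (ev b) × C b ⊆ D) → g ℕ.* (q ^ r ∸ 1) ≡ n ℕ.* B
      via-C (b , b≢0 , C⊆D) = begin
        g ℕ.* (q ^ r ∸ 1)                                   ≡⟨ ≡.cong (g ℕ.*_) #nonzero-functionals≡ ⟨
        g ℕ.* #nonzero-functionals                          ≡⟨ ≡.cong₂ ℕ._*_ g≡∣C∣ (≡.sym #nonzero-scalars*m) ⟩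
        ∣ C b ∣ ℕ.* (#nonzero-scalars ℕ.* m)                 ≡⟨ ≡.cong (ℕ._* (#nonzero-scalars ℕ.* m)) (∣C∣≡k*#points-off b) ⟩
        k ℕ.* #points-off b ℕ.* (#nonzero-scalars ℕ.* m)     ≡⟨ rearrange k (#points-off b) #nonzero-scalars m ⟩
        m ℕ.* k ℕ.* (#nonzero-scalars ℕ.* #points-off b)     ≡⟨ ≡.cong₂ ℕ._*_ (≡.sym n≡m*k) (#nonzero-scalars*#points-off b b≢0) ⟩
        n ℕ.* B                                             ∎
        where
        open ≡.≡-Reasoning
        g≡∣C∣ : g ≡ ∣ C b ∣
        g≡∣C∣ = ℕₚ.≤-antisym (g≤∣C∣ g cogirth b b≢0) (≡.subst (∣ C b ∣ ℕ.≤_) ∣D∣≡g (Subₚ.p⊆q⇒∣p∣≤∣q∣ C⊆D))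

open import Data.Nat using (_*_; _≤_)
open import Data.Nat.Primality using (Prime)

proposition1p2 : (q r : ℕ) → (∃[ p ] ∃[ k ] (Prime p × 1 ≤ k × q ≡ p ^ k)) → 1 ≤ r →
    (F : Field) → FieldOps.HasOrder F q →
    {n : ℕ} (M : Matroid n) → SimpIsoPG M F r →
    (g : ℕ) → IsCogirth M g →
      (g * (q ^ r ∸ 1) ≤ n * (q ^ (r ∸ 1) * (q ∸ 1)))
    × ((g * (q ^ r ∸ 1) ≡ n * (q ^ (r ∸ 1) * (q ∸ 1)))
       ⇔ (Loopless M × ∃[ k ] (∀ (e : Fin n) → ParClassSize M e k)))
proposition1p2 q (suc r′) _ (s≤s _) F order M (S , simple , m , φ , p , points , φ-injective , φ-onto-S , φ-rank) g cogirth =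
  cogirth-bound g cogirth ,
  mk⇔ (λ equality → Forward.loopless g cogirth equality , Forward.equal-parallel-classes g cogirth equality)
      (λ (loopless , k , classes) → Reverse.equality g cogirth loopless k classes)
  where open PGMatroid F order r′ M S simple m φ p points φ-injective φ-onto-S φ-rank
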